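{- Let $r$ be a positive integer, let $k=(2r^2)^r$ and $c=1/(2r^2)$, and let $\mathcal{H}=\mathcal{K}^{(r)}_n(k\text{ -out})$. Then with probability tending to $1$ as $n\to\infty$, every nonempty $X\subseteq [n]$ with $|X|\le cn$ is $(r-1)$-expansive in $\mathcal{H}$.
   Context: $\mathcal{K}^{(r)}_n$ is the complete $r$-graph on $[n]$. For a host hypergraph $\mathcal{H}_0$ on $V$, $\mathcal{H}_0(k\text{ -out})$ is the random subhypergraph $\bigcup_{v\in V}E_v$, where each $E_v$ is chosen uniformly from the $k$-subsets of $\{A\in\mathcal{H}_0: v\in A\}$ (or is all of this set if it has fewer than $k$ elements), independently over $v$. For a hypergraph $\mathcal{H}$ on $V$ and $\lambda>0$, a nonempty $X\subseteq V$ is $\lambda$-expansive if for every $Y\subseteq V\setminus X$ with $|Y|\le\lambda|X|$ there is an edge of $\mathcal{H}$ meeting $X$ but not $Y$. -}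

module Defs where

open import Data.Nat using (ℕ; zero; suc; _+_; _*_; _∸_; _^_; _≤_; _<?_)
open import Data.Nat.Properties using (_≟_)
open import Data.Bool using (Bool; true; false)
open import Data.Fin using (Fin)
open import Data.Fin.Subset using (Subset; inside; outside; ∣_∣; Nonempty; _∈_; _∉_)
open import Data.Fin.Subset.Properties using (_∈?_)
open import Data.List using (List; []; _∷_; [_]; map; _++_; concatMap; filter; length)
import Data.List.Membership.Propositional as LM
open import Data.List.Relation.Binary.Sublist.Propositional using (_⊆_)
open import Data.List.Relation.Unary.All using (All)
open import Data.Vec using (Vec; tabulate; lookup) renaming ([] to []ᵥ; _∷_ to _∷ᵥ_)
open import Data.Product using (Σ; ∃; _×_; _,_)
open import Relation.Nullary using (¬_; yes; no)
open import Relation.Nullary.Decidable using (_×-dec_)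

allSubsets : (n : ℕ) → List (Subset n)
allSubsets zero = [ []ᵥ ]
allSubsets (suc n) = map (outside ∷ᵥ_) (allSubsets n) ++ map (inside ∷ᵥ_) (allSubsets n)

edgesAt : (n r : ℕ) → Fin n → List (Subset n)
edgesAt n r v = filter (λ e → (∣ e ∣ ≟ r) ×-dec (v ∈? e)) (allSubsets n)

choose : {A : Set} → ℕ → List A → List (List A)
choose zero xs = [ [] ]
choose (suc k) [] = []
choose (suc k) (x ∷ xs) = map (x ∷_) (choose k xs) ++ choose (suc k) xs

-- Possible values of E_v: the k-subsets, or the whole set if it has fewer than k elements.
kChoices : {A : Set} → ℕ → List A → List (List A)
kChoices k xs with length xs <? k
... | yes _ = [ xs ]
... | no _ = choose k xs

sequenceV : {A : Set} {m : ℕ} → Vec (List A) m → List (Vec A m)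
sequenceV []ᵥ = [ []ᵥ ]
sequenceV (xs ∷ᵥ xss) = concatMap (λ x → map (x ∷ᵥ_) (sequenceV xss)) xs

-- Sample space of K^(r)_n(k-out): a choice (E_v)_{v ∈ [n]}; each outcome listed once,
-- so the uniform distribution on this list is the product of the independent uniform choices.
Outcome : ℕ → Set
Outcome n = Vec (List (Subset n)) n

outcomes : (n r k : ℕ) → List (Outcome n)
outcomes n r k = sequenceV (tabulate (λ v → kChoices k (edgesAt n r v)))

Hypergraph : ℕ → Set₁
Hypergraph n = Subset n → Set

outHypergraph : {n : ℕ} → Outcome n → Hypergraph n
outHypergraph {n} ω e = ∃ λ (v : Fin n) → e LM.∈ lookup ω v

Expansive : {n : ℕ} → Hypergraph n → ℕ → Subset n → Set
Expansive {n} H lam X =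
  Nonempty X ×
  ((Y : Subset n) → (∀ y → y ∈ Y → y ∉ X) → ∣ Y ∣ ≤ lam * ∣ X ∣ →
     ∃ λ (e : Subset n) → H e × (∃ λ x → x ∈ e × x ∈ X) × (∀ y → y ∈ e → y ∉ Y))

-- "With probability tending to 1": for every m, for all large n, the event holds on a
-- set of outcomes whose complement has probability ≤ 1/m.
ProbTendsToOne : (Ω : ℕ → Set) → (space : (n : ℕ) → List (Ω n)) → (P : (n : ℕ) → Ω n → Set) → Set
ProbTendsToOne Ω space P =
  (m : ℕ) → ∃ λ (N : ℕ) → (n : ℕ) → N ≤ n →
    ∃ λ (good : List (Ω n)) → (good ⊆ space n) × All (P n) good ×
      (m * (length (space n) ∸ length good) ≤ length (space n))

-- First moment method. If a small X (|X| = s ≥ 1, 2 r² s ≤ n) is not (r - 1)-expansive,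
-- some Y disjoint from X with |Y| = (r - 1) s meets every edge chosen by a vertex of X.
-- An edge through v ∉ Y meets Y with probability at most 2 (r - 1) |Y| / n, so all k
-- edges chosen by v meet Y with probability at most (2 (r - 1) |Y| / n)^k, independently
-- over v ∈ X. Since k = (2 r²)^r, the resulting bound (2 (r - 1)² s / n)^(k s) beats the
-- (n C s) (n C (r - 1) s) choices of (X , Y) by a factor m 2^s once n ≥ m, and summing
-- over s leaves a failure probability of at most 1/m. For r = 1 there is nothing to
-- block: Y is empty and every vertex chooses its edge.

module Submission where

open import Defs
open import Data.Nat using (ℕ; _*_; _^_; _∸_; _≤_)
open import Data.Fin.Subset using (Subset; Nonempty; ∣_∣)

open import Data.Nat using (zero; suc; _+_; _<_; z≤n; s≤s; >-nonZero; _≡ᵇ_; _≤ᵇ_; _<?_; _≤?_)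
open import Data.Nat.Properties
open import Data.Nat.Combinatorics using (_C_; nC1≡n; k>n⇒nCk≡0; nCk+nC[k+1]≡[n+1]C[k+1])
open import Data.Nat.Tactic.RingSolver using (solve-∀)
open import Data.Bool using (Bool; true; false; _∧_; _∨_; not; if_then_else_)
open import Data.Bool.Properties using (T-≡; ∧-zeroʳ; ∧-identityʳ; ∧-assoc; ∧-comm; ∧-distribˡ-∨; ∧-conicalˡ; ∧-conicalʳ; ∨-conicalˡ; ∨-conicalʳ; not-injective)
open import Data.Bool.ListAction using (all; any)
open import Data.Nat.ListAction using (sum)
open import Data.List using (List; []; _∷_; map; _++_; concatMap; filter; filterᵇ; length)
open import Data.List.Relation.Unary.All as All using (All)
open import Data.List.Relation.Binary.Sublist.Propositional.Properties using (filter-⊆)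
open import Data.List.Properties using (map-cong)
open import Data.Fin using (Fin) renaming (zero to fzero; suc to fsuc)
open import Data.Fin.Subset using (inside; outside; _∈_; _∉_; _⊆_; ⁅_⁆; _∪_) renaming (⊥ to ∅)
open import Data.Fin.Subset.Properties using (∣p∣≤n; ∣⊥∣≡0; ∣⁅x⁆∣≡1; x∈⁅x⁆; ∪-identityʳ; x≢y⇒x∉⁅y⁆; _∈?_)
open import Data.Vec using (Vec; lookup; tabulate; here; there) renaming ([] to []ᵥ; _∷_ to _∷ᵥ_)
open import Data.Vec.Properties using (lookup⇒[]=; []=⇒lookup)
open import Data.Vec.Functional using (foldr)
open import Data.List.Membership.Propositional using (find) renaming (_∈_ to _∈ˡ_)
open import Data.List.Membership.Propositional.Properties using (∈-map⁺; ∈-map⁻; ∈-++⁺ˡ; ∈-++⁺ʳ; ∈-++⁻; ∈-filter⁺; ∈-filter⁻; ∈-concatMap⁻)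
open import Data.List.Relation.Unary.Any using (here; there)
open import Data.Product using (∃; _×_; _,_; proj₁; proj₂)
open import Data.Sum using (_⊎_; inj₁; inj₂)
open import Relation.Nullary using (does; yes; no; contradiction)
open import Relation.Nullary.Decidable using (T?; _×-dec_)
open import Relation.Unary using (Decidable)
open import Relation.Binary.PropositionalEquality
open import Function using (_∘_; Equivalence)

-- Binomial coefficients

nCk≤[n+1]Ck : ∀ n k → n C k ≤ suc n C k
nCk≤[n+1]Ck n zero = ≤-refl
nCk≤[n+1]Ck n (suc k) = ≤-trans (m≤n+m _ _) (≤-reflexive (nCk+nC[k+1]≡[n+1]C[k+1] n k))

nCk>0 : ∀ {n k} → k ≤ n → 0 < n C k
nCk>0 {k = zero} _ = s≤s z≤n
nCk>0 {suc n} {suc k} (s≤s k≤n) =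
  ≤-trans (nCk>0 k≤n) (≤-trans (m≤m+n _ _) (≤-reflexive (nCk+nC[k+1]≡[n+1]C[k+1] n k)))

n≤nCk : ∀ {n k} → 0 < k → k < n → n ≤ n C k
n≤nCk {suc n} {1} _ _ = ≤-reflexive (sym (nC1≡n (suc n)))
n≤nCk {suc n} {suc (suc k)} _ (s≤s k<n) = begin
  suc n                          ≡⟨ +-comm 1 n ⟩
  n + 1                          ≤⟨ +-mono-≤ (n≤nCk (s≤s z≤n) k<n) (nCk>0 k<n) ⟩
  n C suc k + n C suc (suc k)    ≡⟨ nCk+nC[k+1]≡[n+1]C[k+1] n (suc k) ⟩
  suc n C suc (suc k)            ∎
  where open ≤-Reasoning

[k+1]*[n+1]C[k+1]≡[n+1]*nCk : ∀ n k → suc k * (suc n C suc k) ≡ suc n * (n C k)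
[k+1]*[n+1]C[k+1]≡[n+1]*nCk zero zero = refl
[k+1]*[n+1]C[k+1]≡[n+1]*nCk zero (suc k)
  rewrite k>n⇒nCk≡0 {1} {suc (suc k)} (s≤s (s≤s z≤n)) | k>n⇒nCk≡0 {0} {suc k} (s≤s z≤n) =
  *-zeroʳ (suc (suc k))
[k+1]*[n+1]C[k+1]≡[n+1]*nCk (suc n) zero = trans (*-identityˡ _) (trans (nC1≡n (suc (suc n))) (sym (*-identityʳ _)))
[k+1]*[n+1]C[k+1]≡[n+1]*nCk (suc n) (suc k) = begin
  suc (suc k) * (suc (suc n) C suc (suc k))
    ≡⟨ cong (suc (suc k) *_) (sym (nCk+nC[k+1]≡[n+1]C[k+1] (suc n) (suc k))) ⟩
  suc (suc k) * (a + b)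
    ≡⟨ regroup a (suc k) b ⟩
  a + (suc k * a + suc (suc k) * b)
    ≡⟨ cong₂ (λ x y → a + (x + y)) ([k+1]*[n+1]C[k+1]≡[n+1]*nCk n k) ([k+1]*[n+1]C[k+1]≡[n+1]*nCk n (suc k)) ⟩
  a + (suc n * (n C k) + suc n * (n C suc k))
    ≡⟨ cong (a +_) (sym (*-distribˡ-+ (suc n) (n C k) (n C suc k))) ⟩
  a + suc n * (n C k + n C suc k)
    ≡⟨ cong (λ x → a + suc n * x) (nCk+nC[k+1]≡[n+1]C[k+1] n k) ⟩
  suc (suc n) * a ∎
  where
  open ≡-Reasoning
  a b : ℕ
  a = suc n C suc k
  b = suc n C suc (suc k)
  regroup : ∀ a j b → (1 + j) * (a + b) ≡ a + (j * a + (1 + j) * b)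
  regroup = solve-∀

[k+1]*nC[k+1]≤n*nCk : ∀ n k → suc k * (n C suc k) ≤ n * (n C k)
[k+1]*nC[k+1]≤n*nCk zero k = ≤-reflexive (trans (cong (suc k *_) (k>n⇒nCk≡0 {0} {suc k} (s≤s z≤n))) (*-zeroʳ (suc k)))
[k+1]*nC[k+1]≤n*nCk (suc n) k =
  ≤-trans (≤-reflexive ([k+1]*[n+1]C[k+1]≡[n+1]*nCk n k)) (*-monoʳ-≤ (suc n) (nCk≤[n+1]Ck n k))

-- Elementary inequalities between powers

^-distribʳ-* : ∀ a b k → (a * b) ^ k ≡ a ^ k * b ^ k
^-distribʳ-* a b zero = refl
^-distribʳ-* a b (suc k) rewrite ^-distribʳ-* a b k = shuffle a b (a ^ k) (b ^ k)
  where
  shuffle : ∀ a b x y → a * b * (x * y) ≡ a * x * (b * y)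
  shuffle = solve-∀

1+n≤2^n : ∀ n → suc n ≤ 2 ^ n
1+n≤2^n zero = ≤-refl
1+n≤2^n (suc n) = begin
  suc (suc n)    ≤⟨ s≤s (1+n≤2^n n) ⟩
  1 + 2 ^ n      ≤⟨ +-monoˡ-≤ (2 ^ n) (m^n>0 2 n) ⟩
  2 ^ n + 2 ^ n  ≡⟨ cong (2 ^ n +_) (sym (+-identityʳ (2 ^ n))) ⟩
  2 * 2 ^ n      ∎
  where open ≤-Reasoning

bernoulli : ∀ x p → x ^ p * (x + p) ≤ suc x ^ p * x
bernoulli x zero = ≤-reflexive (cong (_+ 0) (+-identityʳ x))
bernoulli x (suc p) = begin
  x * x ^ p * (x + suc p)              ≤⟨ m≤m+n _ _ ⟩
  x * x ^ p * (x + suc p) + x ^ p * p  ≡⟨ expand x (x ^ p) p ⟩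
  suc x * (x ^ p * (x + p))            ≤⟨ *-monoʳ-≤ (suc x) (bernoulli x p) ⟩
  suc x * (suc x ^ p * x)              ≡⟨ *-assoc (suc x) (suc x ^ p) x ⟨
  suc x * suc x ^ p * x                ∎
  where
  open ≤-Reasoning
  expand : ∀ x y p → x * y * (x + suc p) + y * p ≡ suc x * (y * (x + p))
  expand = solve-∀

2*R^[1+R]≤[1+R]^[1+R] : ∀ R → 2 * R ^ suc R ≤ suc R ^ suc R
2*R^[1+R]≤[1+R]^[1+R] zero = z≤n
2*R^[1+R]≤[1+R]^[1+R] R@(suc _) = *-cancelʳ-≤ _ _ R (begin
  2 * R ^ suc R * R        ≡⟨ double (R ^ suc R) R ⟩
  R ^ suc R * (R + R)      ≤⟨ *-monoʳ-≤ (R ^ suc R) (+-monoʳ-≤ R (n≤1+n R)) ⟩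
  R ^ suc R * (R + suc R)  ≤⟨ bernoulli R (suc R) ⟩
  suc R ^ suc R * R        ∎)
  where
  open ≤-Reasoning
  double : ∀ y R → 2 * y * R ≡ y * (R + R)
  double = solve-∀

r≤2*r^2 : ∀ r → r ≤ 2 * r ^ 2
r≤2*r^2 zero = z≤n
r≤2*r^2 r@(suc _) = ≤-trans (m≤m+n r (r + 0)) (*-monoʳ-≤ 2 (subst (r ≤_) (cong (r *_) (sym (*-identityʳ r))) (m≤m*n r r)))

[1+s]^j*d≤s^[1+j] : ∀ s j d → j + d ≡ s → suc s ^ j * d ≤ s ^ suc j
[1+s]^j*d≤s^[1+j] s zero d j+d≡s = ≤-reflexive (trans (+-identityʳ d) (trans j+d≡s (sym (*-identityʳ s))))
[1+s]^j*d≤s^[1+j] s (suc j) d j+d≡s = begin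
  suc s * suc s ^ j * d    ≡⟨ shuffle (suc s) (suc s ^ j) d ⟩
  suc s ^ j * (suc s * d)  ≤⟨ *-monoʳ-≤ (suc s ^ j) [1+s]*d≤s*[1+d] ⟩
  suc s ^ j * (s * suc d)  ≡⟨ shuffle′ (suc s ^ j) s (suc d) ⟩
  s * (suc s ^ j * suc d)  ≤⟨ *-monoʳ-≤ s ([1+s]^j*d≤s^[1+j] s j (suc d) (trans (+-suc j d) j+d≡s)) ⟩
  s * s ^ suc j            ∎
  where
  open ≤-Reasoning
  shuffle : ∀ a b d → a * b * d ≡ b * (a * d)
  shuffle = solve-∀
  shuffle′ : ∀ a b d → a * (b * d) ≡ b * (a * d)
  shuffle′ = solve-∀
  [1+s]*d≤s*[1+d] : suc s * d ≤ s * suc d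
  [1+s]*d≤s*[1+d] = begin
    d + s * d  ≤⟨ +-monoˡ-≤ (s * d) (subst (d ≤_) j+d≡s (m≤n+m d (suc j))) ⟩
    s + s * d  ≡⟨ *-suc s d ⟨
    s * suc d  ∎

[1+s]^h≤2*s^h : ∀ s h d → h + d ≡ s → s ≤ d + d → suc s ^ h ≤ 2 * s ^ h
[1+s]^h≤2*s^h zero zero d _ _ = s≤s z≤n
[1+s]^h≤2*s^h s@(suc _) h d h+d≡s s≤2d = *-cancelˡ-≤ s (begin
  s * suc s ^ h          ≤⟨ *-monoˡ-≤ (suc s ^ h) s≤2d ⟩
  (d + d) * suc s ^ h    ≡⟨ shuffle d (suc s ^ h) ⟩
  2 * (suc s ^ h * d)    ≤⟨ *-monoʳ-≤ 2 ([1+s]^j*d≤s^[1+j] s h d h+d≡s) ⟩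
  2 * (s * s ^ h)        ≡⟨ shuffle′ s (s ^ h) ⟩
  s * (2 * s ^ h)        ∎)
  where
  open ≤-Reasoning
  shuffle : ∀ d y → (d + d) * y ≡ 2 * (y * d)
  shuffle = solve-∀
  shuffle′ : ∀ s y → 2 * (s * y) ≡ s * (2 * y)
  shuffle′ = solve-∀

even⊎odd : ∀ n → ∃ λ h → n ≡ h + h ⊎ n ≡ suc (h + h)
even⊎odd zero = 0 , inj₁ refl
even⊎odd (suc n) with even⊎odd n
... | h , inj₁ n≡2h = h , inj₂ (cong suc n≡2h)
... | h , inj₂ n≡2h+1 = suc h , inj₁ (trans (cong suc n≡2h+1) (cong suc (sym (+-suc h h))))

-- A weak form of (1 + 1/s)^s ≤ e: bound each half of the exponent separately.
[1+s]^s≤8*s^s : ∀ s → suc s ^ s ≤ 8 * s ^ s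
[1+s]^s≤8*s^s zero = s≤s z≤n
[1+s]^s≤8*s^s s@(suc s′) with even⊎odd s
... | h , inj₁ s≡2h = begin
  suc s ^ s                ≡⟨ cong (suc s ^_) s≡2h ⟩
  suc s ^ (h + h)          ≡⟨ ^-distribˡ-+-* (suc s) h h ⟩
  suc s ^ h * suc s ^ h    ≤⟨ *-mono-≤ half half ⟩
  2 * s ^ h * (2 * s ^ h)  ≡⟨ shuffle (s ^ h) ⟩
  4 * (s ^ h * s ^ h)      ≡⟨ cong (4 *_) (trans (sym (^-distribˡ-+-* s h h)) (cong (s ^_) (sym s≡2h))) ⟩
  4 * s ^ s                ≤⟨ *-monoˡ-≤ (s ^ s) (m≤m+n 4 4) ⟩
  8 * s ^ s                ∎
  where
  open ≤-Reasoning
  half : suc s ^ h ≤ 2 * s ^ h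
  half = [1+s]^h≤2*s^h s h h (sym s≡2h) (≤-reflexive s≡2h)
  shuffle : ∀ y → 2 * y * (2 * y) ≡ 4 * (y * y)
  shuffle = solve-∀
... | h , inj₂ s≡2h+1 = begin
  suc s ^ s                                ≡⟨ cong (suc s ^_) s≡2h+1 ⟩
  suc s * suc s ^ (h + h)                  ≡⟨ cong (suc s *_) (^-distribˡ-+-* (suc s) h h) ⟩
  suc s * (suc s ^ h * suc s ^ h)          ≤⟨ *-mono-≤ (s≤s (m≤n+m s s′)) (*-mono-≤ half half) ⟩
  (s + s) * (2 * s ^ h * (2 * s ^ h))      ≡⟨ shuffle s (s ^ h) ⟩
  8 * (s * (s ^ h * s ^ h))                ≡⟨ cong (λ z → 8 * (s * z)) (sym (^-distribˡ-+-* s h h)) ⟩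
  8 * s ^ suc (h + h)                      ≡⟨ cong (λ z → 8 * s ^ z) (sym s≡2h+1) ⟩
  8 * s ^ s                                ∎
  where
  open ≤-Reasoning
  half : suc s ^ h ≤ 2 * s ^ h
  half = [1+s]^h≤2*s^h s h (suc h) (trans (+-suc h h) (sym s≡2h+1))
           (≤-trans (≤-reflexive s≡2h+1) (≤-trans (n≤1+n _) (≤-reflexive (cong suc (sym (+-suc h h))))))
  shuffle : ∀ s y → (s + s) * (2 * y * (2 * y)) ≡ 8 * (s * (y * y))
  shuffle = solve-∀

nCk*k^k≤8^k*n^k : ∀ n k → (n C k) * k ^ k ≤ 8 ^ k * n ^ k
nCk*k^k≤8^k*n^k n zero = ≤-refl
nCk*k^k≤8^k*n^k n (suc k) = begin
  (n C suc k) * (suc k * suc k ^ k)    ≡⟨ shuffle (n C suc k) (suc k) (suc k ^ k) ⟩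
  suc k * (n C suc k) * suc k ^ k      ≤⟨ *-mono-≤ ([k+1]*nC[k+1]≤n*nCk n k) ([1+s]^s≤8*s^s k) ⟩
  n * (n C k) * (8 * k ^ k)            ≡⟨ shuffle′ n (n C k) (k ^ k) ⟩
  8 * n * ((n C k) * k ^ k)            ≤⟨ *-monoʳ-≤ (8 * n) (nCk*k^k≤8^k*n^k n k) ⟩
  8 * n * (8 ^ k * n ^ k)            ≡⟨ shuffle″ n (8 ^ k) (n ^ k) ⟩
  8 * 8 ^ k * (n * n ^ k)            ∎
  where
  open ≤-Reasoning
  shuffle : ∀ b s y → b * (s * y) ≡ s * b * y
  shuffle = solve-∀
  shuffle′ : ∀ n b y → n * b * (8 * y) ≡ 8 * n * (b * y)
  shuffle′ = solve-∀
  shuffle″ : ∀ n a b → 8 * n * (a * b) ≡ 8 * a * (n * b)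
  shuffle″ = solve-∀

m*s^s≤n^s : ∀ {s n m} → 0 < s → 2 * s ≤ n → m ≤ n → m * s ^ s ≤ n ^ s
m*s^s≤n^s {s@(suc q)} {n} {m} _ 2s≤n m≤n = begin
  m * (s * s ^ q)      ≤⟨ *-mono-≤ m≤n (*-monoˡ-≤ (s ^ q) (1+n≤2^n q)) ⟩
  n * (2 ^ q * s ^ q)  ≡⟨ cong (n *_) (sym (^-distribʳ-* 2 s q)) ⟩
  n * (2 * s) ^ q      ≤⟨ *-monoʳ-≤ n (^-monoˡ-≤ q 2s≤n) ⟩
  n * n ^ q            ∎
  where open ≤-Reasoning

aCk*[1+M]^k≤MCk*[1+a]^k : ∀ k {a M} → a ≤ M → (a C k) * M ^ k ≤ (M C k) * a ^ k →
  (a C k) * suc M ^ k ≤ (M C k) * suc a ^ k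
aCk*[1+M]^k≤MCk*[1+a]^k k {M = zero} z≤n _ = ≤-refl
aCk*[1+M]^k≤MCk*[1+a]^k k {a} {M′@(suc _)} a≤M ratio≤ = *-cancelʳ-≤ _ _ (M′ ^ k) {{>-nonZero (m^n>0 M′ k)}} (begin
  (a C k) * suc M′ ^ k * M′ ^ k    ≡⟨ swap₂ (a C k) (suc M′ ^ k) (M′ ^ k) ⟩
  (a C k) * M′ ^ k * suc M′ ^ k    ≤⟨ *-monoˡ-≤ (suc M′ ^ k) ratio≤ ⟩
  (M′ C k) * a ^ k * suc M′ ^ k    ≡⟨ trans (*-assoc (M′ C k) _ _) (cong ((M′ C k) *_) (sym (^-distribʳ-* a (suc M′) k))) ⟩
  (M′ C k) * (a * suc M′) ^ k      ≤⟨ *-monoʳ-≤ (M′ C k) (^-monoˡ-≤ k a[1+M]≤M[1+a]) ⟩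
  (M′ C k) * (M′ * suc a) ^ k      ≡⟨ trans (cong ((M′ C k) *_) (^-distribʳ-* M′ (suc a) k)) (sym (*-assoc (M′ C k) _ _)) ⟩
  (M′ C k) * M′ ^ k * suc a ^ k    ≡⟨ swap₂ (M′ C k) (M′ ^ k) (suc a ^ k) ⟩
  (M′ C k) * suc a ^ k * M′ ^ k    ∎)
  where
  open ≤-Reasoning
  swap₂ : ∀ b x y → b * x * y ≡ b * y * x
  swap₂ = solve-∀
  a[1+M]≤M[1+a] : a * suc M′ ≤ M′ * suc a
  a[1+M]≤M[1+a] = begin
    a * suc M′   ≡⟨ *-suc a M′ ⟩
    a + a * M′   ≤⟨ +-monoˡ-≤ (a * M′) a≤M ⟩
    M′ + a * M′  ≡⟨ cong (M′ +_) (*-comm a M′) ⟩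
    M′ + M′ * a  ≡⟨ *-suc M′ a ⟨
    M′ * suc a   ∎

aCk*M^k≤MCk*a^k : ∀ k {a M} → a ≤ M → (a C k) * M ^ k ≤ (M C k) * a ^ k
aCk*M^k≤MCk*a^k zero _ = ≤-refl
aCk*M^k≤MCk*a^k (suc k) {zero} _ = z≤n
aCk*M^k≤MCk*a^k (suc k) {suc a} {suc M} (s≤s a≤M) = *-cancelˡ-≤ (suc k) (begin
  suc k * ((suc a C suc k) * (suc M * suc M ^ k))
    ≡⟨ shuffle (suc k) (suc a C suc k) (suc M) (suc M ^ k) ⟩
  suc k * (suc a C suc k) * (suc M * suc M ^ k)
    ≡⟨ cong (_* (suc M * suc M ^ k)) ([k+1]*[n+1]C[k+1]≡[n+1]*nCk a k) ⟩
  suc a * (a C k) * (suc M * suc M ^ k)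
    ≡⟨ shuffle′ (suc a) (a C k) (suc M) (suc M ^ k) ⟩
  suc a * suc M * ((a C k) * suc M ^ k)
    ≤⟨ *-monoʳ-≤ (suc a * suc M) (aCk*[1+M]^k≤MCk*[1+a]^k k a≤M (aCk*M^k≤MCk*a^k k a≤M)) ⟩
  suc a * suc M * ((M C k) * suc a ^ k)
    ≡⟨ shuffle″ (suc a) (suc M) (M C k) (suc a ^ k) ⟩
  suc M * (M C k) * (suc a * suc a ^ k)
    ≡⟨ cong (_* (suc a * suc a ^ k)) ([k+1]*[n+1]C[k+1]≡[n+1]*nCk M k) ⟨
  suc k * (suc M C suc k) * (suc a * suc a ^ k)
    ≡⟨ *-assoc (suc k) (suc M C suc k) (suc a * suc a ^ k) ⟩
  suc k * ((suc M C suc k) * (suc a * suc a ^ k)) ∎)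
  where
  open ≤-Reasoning
  shuffle : ∀ k b m y → k * (b * (m * y)) ≡ k * b * (m * y)
  shuffle = solve-∀
  shuffle′ : ∀ a b m y → a * b * (m * y) ≡ a * m * (b * y)
  shuffle′ = solve-∀
  shuffle″ : ∀ a m b y → a * m * (b * y) ≡ m * b * (a * y)
  shuffle″ = solve-∀

-- With r = R + 1 and k = (2 r²)^r, a fixed X of size s and a disjoint Y of size R s are
-- bad with probability at most (2 R² s / n)^(k s); this has to beat the
-- m 2^s (n C s) (n C R s) choices of the pair.
module Exponent (R : ℕ) where

  r q k k′ : ℕ
  r = suc R
  q = 2 * r ^ 2
  k = q ^ r
  k′ = 2 * r * q ^ R

  k≡r*k′ : k ≡ r * k′
  k≡r*k′ = trans (cong (λ x → 2 * (r * x) * q ^ R) (*-identityʳ r)) (shuffle r (q ^ R))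
    where
    shuffle : ∀ r y → 2 * (r * r) * y ≡ r * (2 * r * y)
    shuffle = solve-∀

  8≤q : 1 ≤ R → 8 ≤ q
  8≤q R≥1 = *-monoʳ-≤ 2 (^-monoˡ-≤ 2 (s≤s R≥1))

  q≤q^R : 1 ≤ R → q ≤ q ^ R
  q≤q^R R≥1 = subst (_≤ q ^ R) (^-identityʳ q) (^-monoʳ-≤ q {{>-nonZero (≤-trans (s≤s z≤n) (8≤q R≥1))}} R≥1)

  16*8^R≤q^[1+r] : 1 ≤ R → 16 * 8 ^ R ≤ q ^ suc r
  16*8^R≤q^[1+r] R≥1 = begin
    16 * 8 ^ R         ≤⟨ *-monoˡ-≤ (8 ^ R) (m≤m+n 16 48) ⟩
    64 * 8 ^ R         ≡⟨ *-assoc 8 8 (8 ^ R) ⟩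
    8 * (8 * 8 ^ R)    ≤⟨ *-mono-≤ (8≤q R≥1) (*-mono-≤ (8≤q R≥1) (^-monoˡ-≤ R (8≤q R≥1))) ⟩
    q * (q * q ^ R)    ∎
    where open ≤-Reasoning

  q^[1+r]≤2^k′ : 1 ≤ R → q ^ suc r ≤ 2 ^ k′
  q^[1+r]≤2^k′ R≥1 = begin
    q ^ suc r          ≤⟨ ^-monoˡ-≤ (suc r) (≤-trans (n≤1+n q) (1+n≤2^n q)) ⟩
    (2 ^ q) ^ suc r    ≡⟨ ^-*-assoc 2 q (suc r) ⟩
    2 ^ (q * suc r)    ≤⟨ ^-monoʳ-≤ 2 q*[1+r]≤k′ ⟩
    2 ^ k′             ∎
    where
    open ≤-Reasoning
    q*[1+r]≤k′ : q * suc r ≤ k′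
    q*[1+r]≤k′ = begin
      q * suc r        ≡⟨ *-comm q (suc r) ⟩
      suc r * q        ≤⟨ *-mono-≤ (s≤s (m≤n+m r R)) (q≤q^R R≥1) ⟩
      (r + r) * q ^ R  ≡⟨ cong (_* q ^ R) (cong (r +_) (sym (+-identityʳ r))) ⟩
      k′               ∎

  [2R²]^k*4^k′≤q^k : (2 * R * R) ^ k * (2 ^ k′ * 2 ^ k′) ≤ q ^ k
  [2R²]^k*4^k′≤q^k = begin
    (2 * R * R) ^ k * (2 ^ k′ * 2 ^ k′)
      ≡⟨ cong (λ x → x * (2 ^ k′ * 2 ^ k′)) (trans (cong (_^ k) (*-assoc 2 R R)) (^-distribʳ-* 2 (R * R) k)) ⟩
    2 ^ k * (R * R) ^ k * (2 ^ k′ * 2 ^ k′)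
      ≡⟨ cong (λ x → 2 ^ k * x * (2 ^ k′ * 2 ^ k′)) (trans (^-distribʳ-* R R k) (cong (λ x → x * x) R^k)) ⟩
    2 ^ k * ((R ^ r) ^ k′ * (R ^ r) ^ k′) * (2 ^ k′ * 2 ^ k′)
      ≡⟨ regroup (2 ^ k) ((R ^ r) ^ k′) (2 ^ k′) ⟩
    2 ^ k * ((2 ^ k′ * (R ^ r) ^ k′) * (2 ^ k′ * (R ^ r) ^ k′))
      ≡⟨ cong (λ x → 2 ^ k * (x * x)) (sym (^-distribʳ-* 2 (R ^ r) k′)) ⟩
    2 ^ k * ((2 * R ^ r) ^ k′ * (2 * R ^ r) ^ k′)
      ≤⟨ *-monoʳ-≤ (2 ^ k) (*-mono-≤ 2R^r≤r^r 2R^r≤r^r) ⟩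
    2 ^ k * ((r ^ r) ^ k′ * (r ^ r) ^ k′)
      ≡⟨ cong (λ x → 2 ^ k * (x * x)) (sym r^k) ⟩
    2 ^ k * (r ^ k * r ^ k)
      ≡⟨ trans (cong (2 ^ k *_) (sym (^-distribʳ-* r r k))) (sym (^-distribʳ-* 2 (r * r) k)) ⟩
    (2 * (r * r)) ^ k
      ≡⟨ cong (λ x → (2 * x) ^ k) (cong (r *_) (*-identityʳ r)) ⟨
    q ^ k ∎
    where
    open ≤-Reasoning
    regroup : ∀ a x y → a * (x * x) * (y * y) ≡ a * ((y * x) * (y * x))
    regroup = solve-∀
    R^k : R ^ k ≡ (R ^ r) ^ k′
    R^k = trans (cong (R ^_) k≡r*k′) (sym (^-*-assoc R r k′))
    r^k : r ^ k ≡ (r ^ r) ^ k′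
    r^k = trans (cong (r ^_) k≡r*k′) (sym (^-*-assoc r r k′))
    2R^r≤r^r : (2 * R ^ r) ^ k′ ≤ (r ^ r) ^ k′
    2R^r≤r^r = ^-monoˡ-≤ k′ (2*R^[1+R]≤[1+R]^[1+R] R)

  16*8^R*[2R²]^k≤q^K : 1 ≤ R → ∀ K → k ≡ suc r + K → 16 * 8 ^ R * (2 * R * R) ^ k ≤ q ^ K
  16*8^R*[2R²]^k≤q^K R≥1 K k≡1+r+K = *-cancelʳ-≤ _ _ (q ^ suc r) {{>-nonZero (m^n>0 q (suc r))}} (begin
    16 * 8 ^ R * (2 * R * R) ^ k * q ^ suc r
      ≡⟨ shuffle (16 * 8 ^ R) ((2 * R * R) ^ k) (q ^ suc r) ⟩
    (2 * R * R) ^ k * (16 * 8 ^ R * q ^ suc r)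
      ≤⟨ *-monoʳ-≤ ((2 * R * R) ^ k) (*-mono-≤ (16*8^R≤q^[1+r] R≥1) (q^[1+r]≤2^k′ R≥1)) ⟩
    (2 * R * R) ^ k * (q ^ suc r * 2 ^ k′)
      ≤⟨ *-monoʳ-≤ ((2 * R * R) ^ k) (*-monoˡ-≤ (2 ^ k′) (q^[1+r]≤2^k′ R≥1)) ⟩
    (2 * R * R) ^ k * (2 ^ k′ * 2 ^ k′)
      ≤⟨ [2R²]^k*4^k′≤q^k ⟩
    q ^ k
      ≡⟨ trans (cong (q ^_) k≡1+r+K) (trans (^-distribˡ-+-* q (suc r) K) (*-comm (q ^ suc r) (q ^ K))) ⟩
    q ^ K * q ^ suc r ∎)
    where
    open ≤-Reasoning
    shuffle : ∀ a b c → a * b * c ≡ b * (a * c)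
    shuffle = solve-∀

  1+r≤k : suc r ≤ k
  1+r≤k = begin
    suc r        ≤⟨ s≤s (m≤n+m r R) ⟩
    r + r        ≡⟨ cong (r +_) (+-identityʳ r) ⟨
    2 * r        ≤⟨ *-monoʳ-≤ 2 (subst (r ≤_) (cong (r *_) (sym (*-identityʳ r))) (m≤m*n r r)) ⟩
    q            ≤⟨ subst (_≤ k) (^-identityʳ q) (^-monoʳ-≤ q {1} {r} (s≤s z≤n)) ⟩
    k            ∎
    where open ≤-Reasoning

  module _ (R≥1 : 1 ≤ R) {s n m : ℕ} (s≥1 : 1 ≤ s) (qs≤n : q * s ≤ n) (m≤n : m ≤ n) where

    private
      K t : ℕ
      K = k ∸ suc r
      t = R * s

      k≡1+r+K : k ≡ suc r + K
      k≡1+r+K = sym (m+[n∸m]≡n 1+r≤k)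

      s^e>0 : ∀ e → 0 < s ^ e
      s^e>0 = m^n>0 s {{>-nonZero s≥1}}

    -- With (n C j) j^j ≤ 8^j n^j the bound reduces to m W^s ≤ s^s V^s, which
    -- follows from n W ≤ s² V and m s^s ≤ n^s.
    Z W V : ℕ
    Z = (2 * R * t) ^ k
    W = 16 * 8 ^ R * n ^ r * Z
    V = n ^ k * s ^ R

    n*W≤s*s*V : n * W ≤ s * s * V
    n*W≤s*s*V = begin
      n * (16 * 8 ^ R * n ^ r * (2 * R * t) ^ k)
        ≡⟨ cong (λ x → n * (16 * 8 ^ R * n ^ r * x)) Z≡ ⟩
      n * (16 * 8 ^ R * (n * n ^ R) * ((2 * R * R) ^ k * (s * (s * s ^ R) * s ^ K)))
        ≡⟨ regroup n (16 * 8 ^ R) (n ^ R) ((2 * R * R) ^ k) s (s ^ R) (s ^ K) ⟩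
      n * (n * n ^ R) * (s * (s * s ^ R)) * (16 * 8 ^ R * (2 * R * R) ^ k * s ^ K)
        ≤⟨ *-monoʳ-≤ (n * (n * n ^ R) * (s * (s * s ^ R))) small ⟩
      n * (n * n ^ R) * (s * (s * s ^ R)) * n ^ K
        ≡⟨ regroup′ n (n ^ R) s (s ^ R) (n ^ K) ⟩
      s * s * (n * (n * n ^ R) * n ^ K * s ^ R)
        ≡⟨ cong (λ x → s * s * (x * s ^ R)) (trans (cong (n ^_) k≡1+r+K) (^-distribˡ-+-* n (suc r) K)) ⟨
      s * s * (n ^ k * s ^ R) ∎
      where
      open ≤-Reasoning
      regroup : ∀ n a b c s x y → n * (a * (n * b) * (c * (s * (s * x) * y))) ≡ n * (n * b) * (s * (s * x)) * (a * c * y)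
      regroup = solve-∀
      regroup′ : ∀ n b s x y → n * (n * b) * (s * (s * x)) * y ≡ s * s * (n * (n * b) * y * x)
      regroup′ = solve-∀
      Z≡ : (2 * R * t) ^ k ≡ (2 * R * R) ^ k * (s * (s * s ^ R) * s ^ K)
      Z≡ = begin-equality
        (2 * R * (R * s)) ^ k          ≡⟨ cong (_^ k) (sym (*-assoc (2 * R) R s)) ⟩
        (2 * R * R * s) ^ k            ≡⟨ ^-distribʳ-* (2 * R * R) s k ⟩
        (2 * R * R) ^ k * s ^ k        ≡⟨ cong (λ x → (2 * R * R) ^ k * s ^ x) k≡1+r+K ⟩
        (2 * R * R) ^ k * s ^ (suc r + K)  ≡⟨ cong ((2 * R * R) ^ k *_) (^-distribˡ-+-* s (suc r) K) ⟩
        (2 * R * R) ^ k * (s * (s * s ^ R) * s ^ K) ∎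
      small : 16 * 8 ^ R * (2 * R * R) ^ k * s ^ K ≤ n ^ K
      small = begin
        16 * 8 ^ R * (2 * R * R) ^ k * s ^ K  ≤⟨ *-monoˡ-≤ (s ^ K) (16*8^R*[2R²]^k≤q^K R≥1 K k≡1+r+K) ⟩
        q ^ K * s ^ K                         ≡⟨ ^-distribʳ-* q s K ⟨
        (q * s) ^ K                           ≤⟨ ^-monoˡ-≤ K qs≤n ⟩
        n ^ K                                 ∎

    m*W^s≤s^s*V^s : m * W ^ s ≤ s ^ s * V ^ s
    m*W^s≤s^s*V^s = *-cancelˡ-≤ (s ^ s) {{>-nonZero (s^e>0 s)}} (begin
      s ^ s * (m * W ^ s)    ≡⟨ shuffle (s ^ s) m (W ^ s) ⟩
      m * s ^ s * W ^ s      ≤⟨ *-monoˡ-≤ (W ^ s) (m*s^s≤n^s s≥1 2s≤n m≤n) ⟩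
      n ^ s * W ^ s          ≡⟨ ^-distribʳ-* n W s ⟨
      (n * W) ^ s            ≤⟨ ^-monoˡ-≤ s n*W≤s*s*V ⟩
      (s * s * V) ^ s        ≡⟨ trans (^-distribʳ-* (s * s) V s) (cong (_* V ^ s) (^-distribʳ-* s s s)) ⟩
      s ^ s * s ^ s * V ^ s  ≡⟨ *-assoc (s ^ s) (s ^ s) (V ^ s) ⟩
      s ^ s * (s ^ s * V ^ s) ∎)
      where
      open ≤-Reasoning
      shuffle : ∀ a m w → a * (m * w) ≡ m * a * w
      shuffle = solve-∀
      2s≤n : 2 * s ≤ n
      2s≤n = ≤-trans (*-monoˡ-≤ s (≤-trans (m≤m+n 2 6) (8≤q R≥1))) qs≤n

    W^s≡ : W ^ s ≡ 2 ^ s * (8 ^ s * n ^ s) * (8 ^ t * n ^ t) * Z ^ s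
    W^s≡ = begin
      (16 * 8 ^ R * n ^ r * Z) ^ s
        ≡⟨ trans (^-distribʳ-* (16 * 8 ^ R * n ^ r) Z s) (cong (_* Z ^ s) (^-distribʳ-* (16 * 8 ^ R) (n ^ r) s)) ⟩
      (16 * 8 ^ R) ^ s * (n * n ^ R) ^ s * Z ^ s
        ≡⟨ cong₂ (λ a b → a * b * Z ^ s) (^-distribʳ-* 16 (8 ^ R) s) (^-distribʳ-* n (n ^ R) s) ⟩
      16 ^ s * (8 ^ R) ^ s * (n ^ s * (n ^ R) ^ s) * Z ^ s
        ≡⟨ cong₂ (λ a b → a * b * (n ^ s * (n ^ R) ^ s) * Z ^ s) (^-distribʳ-* 2 8 s) (^-*-assoc 8 R s) ⟩
      2 ^ s * 8 ^ s * 8 ^ t * (n ^ s * (n ^ R) ^ s) * Z ^ s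
        ≡⟨ cong (λ x → 2 ^ s * 8 ^ s * 8 ^ t * (n ^ s * x) * Z ^ s) (^-*-assoc n R s) ⟩
      2 ^ s * 8 ^ s * 8 ^ t * (n ^ s * n ^ t) * Z ^ s
        ≡⟨ regroup (2 ^ s) (8 ^ s) (8 ^ t) (n ^ s) (n ^ t) (Z ^ s) ⟩
      2 ^ s * (8 ^ s * n ^ s) * (8 ^ t * n ^ t) * Z ^ s ∎
      where
      open ≡-Reasoning
      regroup : ∀ a b c d e f → a * b * c * (d * e) * f ≡ a * (b * d) * (c * e) * f
      regroup = solve-∀

    m*2^s*nCs*nCt*Z^s≤[n^k]^s : m * 2 ^ s * (n C s) * (n C t) * Z ^ s ≤ (n ^ k) ^ s
    m*2^s*nCs*nCt*Z^s≤[n^k]^s = *-cancelʳ-≤ _ _ (s ^ s * s ^ t) {{>-nonZero (*-mono-< (s^e>0 s) (s^e>0 t))}} (begin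
      m * 2 ^ s * (n C s) * (n C t) * Z ^ s * (s ^ s * s ^ t)
        ≡⟨ regroup m (2 ^ s) (n C s) (n C t) (Z ^ s) (s ^ s) (s ^ t) ⟩
      m * (2 ^ s * ((n C s) * s ^ s) * ((n C t) * s ^ t) * Z ^ s)
        ≤⟨ *-monoʳ-≤ m (*-monoˡ-≤ (Z ^ s) (*-mono-≤ (*-monoʳ-≤ (2 ^ s) (nCk*k^k≤8^k*n^k n s)) nCt*s^t≤8^t*n^t)) ⟩
      m * (2 ^ s * (8 ^ s * n ^ s) * (8 ^ t * n ^ t) * Z ^ s)
        ≡⟨ cong (m *_) (sym W^s≡) ⟩
      m * W ^ s
        ≤⟨ m*W^s≤s^s*V^s ⟩
      s ^ s * V ^ s
        ≡⟨ cong (s ^ s *_) (trans (^-distribʳ-* (n ^ k) (s ^ R) s) (cong ((n ^ k) ^ s *_) (^-*-assoc s R s))) ⟩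
      s ^ s * ((n ^ k) ^ s * s ^ t)
        ≡⟨ shuffle (s ^ s) ((n ^ k) ^ s) (s ^ t) ⟩
      (n ^ k) ^ s * (s ^ s * s ^ t) ∎)
      where
      open ≤-Reasoning
      regroup : ∀ m a b c z x y → m * a * b * c * z * (x * y) ≡ m * (a * (b * x) * (c * y) * z)
      regroup = solve-∀
      shuffle : ∀ a b c → a * (b * c) ≡ b * (a * c)
      shuffle = solve-∀
      nCt*s^t≤8^t*n^t : (n C t) * s ^ t ≤ 8 ^ t * n ^ t
      nCt*s^t≤8^t*n^t = ≤-trans (*-monoʳ-≤ (n C t) (^-monoˡ-≤ t (subst (_≤ R * s) (*-identityˡ s) (*-monoˡ-≤ s R≥1)))) (nCk*k^k≤8^k*n^k n t)

-- Counting with Boolean predicates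

count : {A : Set} → (A → Bool) → List A → ℕ
count p [] = 0
count p (x ∷ xs) = if p x then suc (count p xs) else count p xs

module _ {A : Set} where

  count-++ : ∀ (p : A → Bool) xs ys → count p (xs ++ ys) ≡ count p xs + count p ys
  count-++ p [] ys = refl
  count-++ p (x ∷ xs) ys with p x
  ... | true = cong suc (count-++ p xs ys)
  ... | false = count-++ p xs ys

  count-cong : ∀ {p q : A → Bool} → (∀ x → p x ≡ q x) → ∀ xs → count p xs ≡ count q xs
  count-cong p≗q [] = refl
  count-cong {p} {q} p≗q (x ∷ xs) rewrite p≗q x with q x
  ... | true = cong suc (count-cong p≗q xs)
  ... | false = count-cong p≗q xs

  count-false : ∀ xs → count (λ (_ : A) → false) xs ≡ 0
  count-false [] = refl
  count-false (x ∷ xs) = count-false xs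

  count-true : ∀ xs → count (λ (_ : A) → true) xs ≡ length xs
  count-true [] = refl
  count-true (x ∷ xs) = cong suc (count-true xs)

  count≤length : ∀ (p : A → Bool) xs → count p xs ≤ length xs
  count≤length p [] = z≤n
  count≤length p (x ∷ xs) with p x
  ... | true = s≤s (count≤length p xs)
  ... | false = m≤n⇒m≤1+n (count≤length p xs)

  count-mono : ∀ {p q : A → Bool} → (∀ x → p x ≡ true → q x ≡ true) → ∀ xs → count p xs ≤ count q xs
  count-mono p⇒q [] = z≤n
  count-mono {p} {q} p⇒q (x ∷ xs) with p x in px | q x in qx
  ... | true | true = s≤s (count-mono p⇒q xs)
  ... | true | false with () ← trans (sym (p⇒q x px)) qx
  ... | false | true = m≤n⇒m≤1+n (count-mono p⇒q xs)
  ... | false | false = count-mono p⇒q xs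

  count-∨ : ∀ (p q : A → Bool) xs → count (λ x → p x ∨ q x) xs ≤ count p xs + count q xs
  count-∨ p q [] = z≤n
  count-∨ p q (x ∷ xs) with p x | q x
  ... | true | true = s≤s (≤-trans (count-∨ p q xs) (≤-trans (n≤1+n _) (≤-reflexive (sym (+-suc _ _)))))
  ... | true | false = s≤s (count-∨ p q xs)
  ... | false | true = ≤-trans (s≤s (count-∨ p q xs)) (≤-reflexive (sym (+-suc _ _)))
  ... | false | false = count-∨ p q xs

  count-∧ : ∀ b (p : A → Bool) xs → count (λ x → b ∧ p x) xs ≡ (if b then count p xs else 0)
  count-∧ true p xs = refl
  count-∧ false p xs = count-false xs

  count+count-not : ∀ (p : A → Bool) xs → count p xs + count (not ∘ p) xs ≡ length xs
  count+count-not p [] = refl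
  count+count-not p (x ∷ xs) with p x
  ... | true = cong suc (count+count-not p xs)
  ... | false = trans (+-suc _ _) (cong suc (count+count-not p xs))

  length-filter : ∀ {P : A → Set} (P? : Decidable P) xs → length (filter P? xs) ≡ count (does ∘ P?) xs
  length-filter P? [] = refl
  length-filter P? (x ∷ xs) with does (P? x)
  ... | true = cong suc (length-filter P? xs)
  ... | false = length-filter P? xs

  count-filter : ∀ {P : A → Set} (P? : Decidable P) (p : A → Bool) xs →
    count p (filter P? xs) ≡ count (λ x → does (P? x) ∧ p x) xs
  count-filter P? p [] = refl
  count-filter P? p (x ∷ xs) with does (P? x)
  ... | false = count-filter P? p xs
  ... | true with p x
  ...   | true = cong suc (count-filter P? p xs)
  ...   | false = count-filter P? p xs

module _ {A B : Set} where

  count-map : ∀ (p : B → Bool) (f : A → B) xs → count p (map f xs) ≡ count (p ∘ f) xs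
  count-map p f [] = refl
  count-map p f (x ∷ xs) with p (f x)
  ... | true = cong suc (count-map p f xs)
  ... | false = count-map p f xs

  count-concatMap : ∀ (p : B → Bool) (f : A → List B) xs → count p (concatMap f xs) ≡ sum (map (count p ∘ f) xs)
  count-concatMap p f [] = refl
  count-concatMap p f (x ∷ xs) = trans (count-++ p (f x) (concatMap f xs)) (cong (count p (f x) +_) (count-concatMap p f xs))

  count-any : ∀ (p : B → A → Bool) (ys : List B) xs → count (λ x → any (λ y → p y x) ys) xs ≤ sum (map (λ y → count (p y) xs) ys)
  count-any p [] xs = ≤-reflexive (count-false xs)
  count-any p (y ∷ ys) xs = ≤-trans (count-∨ (p y) (λ x → any (λ y → p y x) ys) xs) (+-monoʳ-≤ (count (p y) xs) (count-any p ys xs))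

sum-map-mono-≤ : ∀ {A : Set} {f g : A → ℕ} → (∀ x → f x ≤ g x) → ∀ xs → sum (map f xs) ≤ sum (map g xs)
sum-map-mono-≤ f≤g [] = z≤n
sum-map-mono-≤ f≤g (x ∷ xs) = +-mono-≤ (f≤g x) (sum-map-mono-≤ f≤g xs)

*-sum-if≤count*T : ∀ {A : Set} (c : A → Bool) (g : A → ℕ) W T → (∀ x → c x ≡ true → W * g x ≤ T) →
  ∀ xs → W * sum (map (λ x → if c x then g x else 0) xs) ≤ count c xs * T
*-sum-if≤count*T c g W T bound [] = ≤-reflexive (*-zeroʳ W)
*-sum-if≤count*T c g W T bound (x ∷ xs) with c x in cx
... | true = begin
  W * (g x + rest)      ≡⟨ *-distribˡ-+ W (g x) rest ⟩
  W * g x + W * rest    ≤⟨ +-mono-≤ (bound x cx) (*-sum-if≤count*T c g W T bound xs) ⟩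
  T + count c xs * T    ∎
  where
  open ≤-Reasoning
  rest : ℕ
  rest = sum (map (λ x → if c x then g x else 0) xs)
... | false = *-sum-if≤count*T c g W T bound xs

sum-count-∧ : ∀ {A B : Set} (p : A → Bool) (q : B → Bool) ys xs →
  sum (map (λ x → count (λ y → p x ∧ q y) ys) xs) ≡ count p xs * count q ys
sum-count-∧ p q ys [] = refl
sum-count-∧ p q ys (x ∷ xs) with p x
... | true = cong (count q ys +_) (sum-count-∧ p q ys xs)
... | false = trans (cong (_+ sum (map (λ x → count (λ y → p x ∧ q y) ys) xs)) (count-false ys)) (sum-count-∧ p q ys xs)

count-all-choose : ∀ {A : Set} (p : A → Bool) k xs → count (all p) (choose k xs) ≡ count p xs C k
count-all-choose p zero xs = refl
count-all-choose p (suc k) [] = refl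
count-all-choose p (suc k) (x ∷ xs) = begin
  count (all p) (map (x ∷_) (choose k xs) ++ choose (suc k) xs)
    ≡⟨ count-++ (all p) (map (x ∷_) (choose k xs)) (choose (suc k) xs) ⟩
  count (all p) (map (x ∷_) (choose k xs)) + count (all p) (choose (suc k) xs)
    ≡⟨ cong₂ _+_ (trans (count-map (all p) (x ∷_) (choose k xs)) (count-∧ (p x) (all p) (choose k xs)))
                 (count-all-choose p (suc k) xs) ⟩
  (if p x then count (all p) (choose k xs) else 0) + count p xs C suc k
    ≡⟨ pascal (p x) ⟩
  count p (x ∷ xs) C suc k ∎
  where
  open ≡-Reasoning
  pascal : ∀ b → (if b then count (all p) (choose k xs) else 0) + count p xs C suc k
               ≡ (if b then suc (count p xs) else count p xs) C suc k
  pascal true = trans (cong (_+ count p xs C suc k) (count-all-choose p k xs)) (nCk+nC[k+1]≡[n+1]C[k+1] (count p xs) k)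
  pascal false = refl

length-choose : ∀ {A : Set} k (xs : List A) → length (choose k xs) ≡ length xs C k
length-choose k xs = begin
  length (choose k xs)                        ≡⟨ count-true (choose k xs) ⟨
  count (λ _ → true) (choose k xs)            ≡⟨ count-cong all-true (choose k xs) ⟩
  count (all (λ _ → true)) (choose k xs)      ≡⟨ count-all-choose (λ _ → true) k xs ⟩
  count (λ _ → true) xs C k                   ≡⟨ cong (_C k) (count-true xs) ⟩
  length xs C k                               ∎
  where
  open ≡-Reasoning
  all-true : ∀ l → true ≡ all (λ _ → true) l
  all-true [] = refl
  all-true (_ ∷ l) = all-true l

-- Products of independent choices

productᶠ sumᶠ : ∀ {n} → (Fin n → ℕ) → ℕ
productᶠ = foldr _*_ 1
sumᶠ = foldr _+_ 0

allᶠ anyᶠ : ∀ {n} → (Fin n → Bool) → Bool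
allᶠ = foldr _∧_ true
anyᶠ = foldr _∨_ false

count-allᶠ-sequence : ∀ {A : Set} n (q : Fin n → A → Bool) (L : Fin n → List A) →
  count (λ ω → allᶠ (λ i → q i (lookup ω i))) (sequenceV (tabulate L)) ≡ productᶠ (λ i → count (q i) (L i))
count-allᶠ-sequence zero q L = refl
count-allᶠ-sequence {A} (suc n) q L = begin
  count P (concatMap (λ x → map (x ∷ᵥ_) rest) (L fzero))
    ≡⟨ count-concatMap P (λ x → map (x ∷ᵥ_) rest) (L fzero) ⟩
  sum (map (λ x → count P (map (x ∷ᵥ_) rest)) (L fzero))
    ≡⟨ cong sum (map-cong (λ x → count-map P (x ∷ᵥ_) rest) (L fzero)) ⟩
  sum (map (λ x → count (λ ω → q fzero x ∧ P′ ω) rest) (L fzero))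
    ≡⟨ sum-count-∧ (q fzero) P′ rest (L fzero) ⟩
  count (q fzero) (L fzero) * count P′ rest
    ≡⟨ cong (count (q fzero) (L fzero) *_) (count-allᶠ-sequence n (λ i → q (fsuc i)) (λ i → L (fsuc i))) ⟩
  productᶠ (λ i → count (q i) (L i)) ∎
  where
  open ≡-Reasoning
  rest : List (Vec A n)
  rest = sequenceV (tabulate (λ i → L (fsuc i)))
  P : Vec A (suc n) → Bool
  P ω = allᶠ (λ i → q i (lookup ω i))
  P′ : Vec A n → Bool
  P′ ω = allᶠ (λ i → q (fsuc i) (lookup ω i))

length-sequence : ∀ {A : Set} n (L : Fin n → List A) → length (sequenceV (tabulate L)) ≡ productᶠ (λ i → length (L i))
length-sequence {A} n L = begin
  length S                                  ≡⟨ count-true S ⟨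
  count (λ _ → true) S                      ≡⟨ count-cong (λ _ → allᶠ-true n) S ⟩
  count (λ _ → allᶠ {n} (λ _ → true)) S     ≡⟨ count-allᶠ-sequence n (λ _ _ → true) L ⟩
  productᶠ (λ i → count (λ _ → true) (L i)) ≡⟨ productᶠ-cong n (λ i → count-true (L i)) ⟩
  productᶠ (λ i → length (L i))             ∎
  where
  open ≡-Reasoning
  S : List (Vec A n)
  S = sequenceV (tabulate L)
  allᶠ-true : ∀ n → true ≡ allᶠ {n} (λ _ → true)
  allᶠ-true zero = refl
  allᶠ-true (suc n) = allᶠ-true n
  productᶠ-cong : ∀ n {f g : Fin n → ℕ} → (∀ i → f i ≡ g i) → productᶠ f ≡ productᶠ g
  productᶠ-cong zero f≗g = refl
  productᶠ-cong (suc n) f≗g = cong₂ _*_ (f≗g fzero) (productᶠ-cong n (λ i → f≗g (fsuc i)))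

productᶠ*D^∣X∣≤productᶠ*B^∣X∣ : ∀ {n} (X : Subset n) (c T : Fin n → ℕ) D B →
  (∀ i → lookup X i ≡ true → c i * D ≤ T i * B) → (∀ i → lookup X i ≡ false → c i ≤ T i) →
  productᶠ c * D ^ ∣ X ∣ ≤ productᶠ T * B ^ ∣ X ∣
productᶠ*D^∣X∣≤productᶠ*B^∣X∣ []ᵥ c T D B _ _ = ≤-refl
productᶠ*D^∣X∣≤productᶠ*B^∣X∣ (true ∷ᵥ X) c T D B in-X out-X = begin
  c fzero * productᶠ (c ∘ fsuc) * (D * D ^ ∣ X ∣)      ≡⟨ regroup (c fzero) (productᶠ (c ∘ fsuc)) D (D ^ ∣ X ∣) ⟩
  (c fzero * D) * (productᶠ (c ∘ fsuc) * D ^ ∣ X ∣)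
    ≤⟨ *-mono-≤ (in-X fzero refl) (productᶠ*D^∣X∣≤productᶠ*B^∣X∣ X (c ∘ fsuc) (T ∘ fsuc) D B (in-X ∘ fsuc) (out-X ∘ fsuc)) ⟩
  (T fzero * B) * (productᶠ (T ∘ fsuc) * B ^ ∣ X ∣)    ≡⟨ regroup (T fzero) (productᶠ (T ∘ fsuc)) B (B ^ ∣ X ∣) ⟨
  T fzero * productᶠ (T ∘ fsuc) * (B * B ^ ∣ X ∣)      ∎
  where
  open ≤-Reasoning
  regroup : ∀ a b d e → a * b * (d * e) ≡ (a * d) * (b * e)
  regroup = solve-∀
productᶠ*D^∣X∣≤productᶠ*B^∣X∣ (false ∷ᵥ X) c T D B in-X out-X = begin
  c fzero * productᶠ (c ∘ fsuc) * D ^ ∣ X ∣            ≡⟨ *-assoc (c fzero) _ _ ⟩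
  c fzero * (productᶠ (c ∘ fsuc) * D ^ ∣ X ∣)
    ≤⟨ *-mono-≤ (out-X fzero refl) (productᶠ*D^∣X∣≤productᶠ*B^∣X∣ X (c ∘ fsuc) (T ∘ fsuc) D B (in-X ∘ fsuc) (out-X ∘ fsuc)) ⟩
  T fzero * (productᶠ (T ∘ fsuc) * B ^ ∣ X ∣)          ≡⟨ *-assoc (T fzero) _ _ ⟨
  T fzero * productᶠ (T ∘ fsuc) * B ^ ∣ X ∣            ∎
  where
  open ≤-Reasoning

count-anyᶠ : ∀ {A : Set} n (p : Fin n → A → Bool) xs → count (λ x → anyᶠ (λ i → p i x)) xs ≤ sumᶠ (λ i → count (p i) xs)
count-anyᶠ zero p xs = ≤-reflexive (count-false xs)
count-anyᶠ (suc n) p xs = ≤-trans (count-∨ (p fzero) (λ x → anyᶠ (λ i → p (fsuc i) x)) xs)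
  (+-monoʳ-≤ (count (p fzero) xs) (count-anyᶠ n (p ∘ fsuc) xs))

any≡false⁻ : ∀ {A : Set} (p : A → Bool) {xs x} → any p xs ≡ false → x ∈ˡ xs → p x ≡ false
any≡false⁻ p {y ∷ _} any≡false (here refl) = ∨-conicalˡ (p y) _ any≡false
any≡false⁻ p {y ∷ _} any≡false (there x∈xs) = any≡false⁻ p (∨-conicalʳ (p y) _ any≡false) x∈xs

all≡false⁻ : ∀ {A : Set} (p : A → Bool) xs → all p xs ≡ false → ∃ λ x → x ∈ˡ xs × p x ≡ false
all≡false⁻ p (x ∷ xs) all≡false with p x in px
... | false = x , here refl , px
... | true with y , y∈xs , py ← all≡false⁻ p xs all≡false = y , there y∈xs , py

anyᶠ≡false⁻ : ∀ {n} (f : Fin n → Bool) → anyᶠ f ≡ false → ∀ i → f i ≡ false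
anyᶠ≡false⁻ {suc n} f any≡false fzero = ∨-conicalˡ (f fzero) _ any≡false
anyᶠ≡false⁻ {suc n} f any≡false (fsuc i) = anyᶠ≡false⁻ (f ∘ fsuc) (∨-conicalʳ (f fzero) _ any≡false) i

anyᶠ≡false⁺ : ∀ {n} (f : Fin n → Bool) → (∀ i → f i ≡ false) → anyᶠ f ≡ false
anyᶠ≡false⁺ {zero} f _ = refl
anyᶠ≡false⁺ {suc n} f f≡false rewrite f≡false fzero = anyᶠ≡false⁺ (f ∘ fsuc) (f≡false ∘ fsuc)

allᶠ≡false⁻ : ∀ {n} (f : Fin n → Bool) → allᶠ f ≡ false → ∃ λ i → f i ≡ false
allᶠ≡false⁻ {suc n} f all≡false with f fzero in f₀
... | false = fzero , f₀
... | true with i , fi ← allᶠ≡false⁻ (f ∘ fsuc) all≡false = fsuc i , fi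

true∧b≡false : ∀ {a b} → a ≡ true → a ∧ b ≡ false → b ≡ false
true∧b≡false refl b≡false = b≡false

≤⇒≤ᵇ≡true : ∀ {a b} → a ≤ b → (a ≤ᵇ b) ≡ true
≤⇒≤ᵇ≡true a≤b = Equivalence.to T-≡ (≤⇒≤ᵇ a≤b)

≡⇒≡ᵇ≡true : ∀ {a b} → a ≡ b → (a ≡ᵇ b) ≡ true
≡⇒≡ᵇ≡true {a} refl = Equivalence.to T-≡ (≡⇒≡ᵇ a a refl)

_⊆ᵇ_ : ∀ {n} → Subset n → Subset n → Bool
[]ᵥ ⊆ᵇ []ᵥ = true
(true ∷ᵥ F) ⊆ᵇ (x ∷ᵥ e) = x ∧ (F ⊆ᵇ e)
(false ∷ᵥ F) ⊆ᵇ (x ∷ᵥ e) = F ⊆ᵇ e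

supersetsOfSize : ∀ {n} → Subset n → ℕ → ℕ
supersetsOfSize {n} F r = count (λ e → (∣ e ∣ ≡ᵇ r) ∧ (F ⊆ᵇ e)) (allSubsets n)

count-allSubsets-suc : ∀ n (P : Subset (suc n) → Bool) →
  count P (allSubsets (suc n)) ≡ count (P ∘ (outside ∷ᵥ_)) (allSubsets n) + count (P ∘ (inside ∷ᵥ_)) (allSubsets n)
count-allSubsets-suc n P = trans (count-++ P (map (outside ∷ᵥ_) (allSubsets n)) (map (inside ∷ᵥ_) (allSubsets n)))
  (cong₂ _+_ (count-map P (outside ∷ᵥ_) (allSubsets n)) (count-map P (inside ∷ᵥ_) (allSubsets n)))

module _ {n : ℕ} (F : Subset n) where

  private
    count-∧-false : ∀ (b : Subset n → Bool) → count (λ e → b e ∧ false) (allSubsets n) ≡ 0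
    count-∧-false b = trans (count-cong (λ e → ∧-zeroʳ (b e)) (allSubsets n)) (count-false (allSubsets n))

  supersetsOfSize-inside : ∀ r → supersetsOfSize (inside ∷ᵥ F) (suc r) ≡ supersetsOfSize F r
  supersetsOfSize-inside r = trans (count-allSubsets-suc n _) (cong (_+ supersetsOfSize F r) (count-∧-false (λ e → ∣ e ∣ ≡ᵇ suc r)))

  supersetsOfSize-inside-0 : supersetsOfSize (inside ∷ᵥ F) 0 ≡ 0
  supersetsOfSize-inside-0 = trans (count-allSubsets-suc n _) (cong₂ _+_ (count-∧-false (λ e → ∣ e ∣ ≡ᵇ 0)) (count-false (allSubsets n)))

  supersetsOfSize-outside : ∀ r → supersetsOfSize (outside ∷ᵥ F) (suc r) ≡ supersetsOfSize F (suc r) + supersetsOfSize F r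
  supersetsOfSize-outside r = count-allSubsets-suc n _

  supersetsOfSize-outside-0 : supersetsOfSize (outside ∷ᵥ F) 0 ≡ supersetsOfSize F 0 + 0
  supersetsOfSize-outside-0 = trans (count-allSubsets-suc n _) (cong (supersetsOfSize F 0 +_) (count-false (allSubsets n)))

supersetsOfSize-< : ∀ {n} (F : Subset n) r → r < ∣ F ∣ → supersetsOfSize F r ≡ 0
supersetsOfSize-< (inside ∷ᵥ F) zero _ = supersetsOfSize-inside-0 F
supersetsOfSize-< (inside ∷ᵥ F) (suc r) (s≤s r<∣F∣) = trans (supersetsOfSize-inside F r) (supersetsOfSize-< F r r<∣F∣)
supersetsOfSize-< (outside ∷ᵥ F) zero 0<∣F∣ =
  trans (supersetsOfSize-outside-0 F) (cong (_+ 0) (supersetsOfSize-< F 0 0<∣F∣))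
supersetsOfSize-< (outside ∷ᵥ F) (suc r) r<∣F∣ =
  trans (supersetsOfSize-outside F r) (cong₂ _+_ (supersetsOfSize-< F (suc r) r<∣F∣) (supersetsOfSize-< F r (<-trans (n<1+n r) r<∣F∣)))

-- A superset of F of size |F| + j is F together with j of the n - |F| other points.
supersetsOfSize-+ : ∀ {n} (F : Subset n) j → supersetsOfSize F (∣ F ∣ + j) ≡ (n ∸ ∣ F ∣) C j
supersetsOfSize-+ []ᵥ zero = refl
supersetsOfSize-+ []ᵥ (suc j) = refl
supersetsOfSize-+ (inside ∷ᵥ F) j = trans (supersetsOfSize-inside F (∣ F ∣ + j)) (supersetsOfSize-+ F j)
supersetsOfSize-+ (outside ∷ᵥ F) zero = trans (no-new-point (∣ F ∣ + 0) (≤-reflexive (+-identityʳ ∣ F ∣))) (supersetsOfSize-+ F 0)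
  where
  no-new-point : ∀ r → r ≤ ∣ F ∣ → supersetsOfSize (outside ∷ᵥ F) r ≡ supersetsOfSize F r
  no-new-point zero _ = trans (supersetsOfSize-outside-0 F) (+-identityʳ _)
  no-new-point (suc r) r<∣F∣ = trans (supersetsOfSize-outside F r) (trans (cong (supersetsOfSize F (suc r) +_) (supersetsOfSize-< F r r<∣F∣)) (+-identityʳ _))
supersetsOfSize-+ {suc n} (outside ∷ᵥ F) (suc j) = begin
  supersetsOfSize (outside ∷ᵥ F) (∣ F ∣ + suc j)
    ≡⟨ cong (supersetsOfSize (outside ∷ᵥ F)) (+-suc ∣ F ∣ j) ⟩
  supersetsOfSize (outside ∷ᵥ F) (suc (∣ F ∣ + j))
    ≡⟨ supersetsOfSize-outside F (∣ F ∣ + j) ⟩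
  supersetsOfSize F (suc (∣ F ∣ + j)) + supersetsOfSize F (∣ F ∣ + j)
    ≡⟨ cong₂ _+_ (trans (cong (supersetsOfSize F) (sym (+-suc ∣ F ∣ j))) (supersetsOfSize-+ F (suc j))) (supersetsOfSize-+ F j) ⟩
  (n ∸ ∣ F ∣) C suc j + (n ∸ ∣ F ∣) C j
    ≡⟨ trans (+-comm ((n ∸ ∣ F ∣) C suc j) _) (nCk+nC[k+1]≡[n+1]C[k+1] (n ∸ ∣ F ∣) j) ⟩
  suc (n ∸ ∣ F ∣) C suc j
    ≡⟨ cong (_C suc j) (+-∸-assoc 1 (∣p∣≤n F)) ⟨
  (suc n ∸ ∣ F ∣) C suc j ∎
  where open ≡-Reasoning

∈-allSubsets : ∀ {n} (S : Subset n) → S ∈ˡ allSubsets n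
∈-allSubsets []ᵥ = here refl
∈-allSubsets {suc n} (outside ∷ᵥ S) = ∈-++⁺ˡ (∈-map⁺ (outside ∷ᵥ_) (∈-allSubsets S))
∈-allSubsets {suc n} (inside ∷ᵥ S) = ∈-++⁺ʳ (map (outside ∷ᵥ_) (allSubsets n)) (∈-map⁺ (inside ∷ᵥ_) (∈-allSubsets S))

∉⇒lookup≡false : ∀ {n} {x : Fin n} {p : Subset n} → x ∉ p → lookup p x ≡ false
∉⇒lookup≡false {x = x} {p} x∉p with lookup p x in px
... | false = refl
... | true = contradiction (lookup⇒[]= x p px) x∉p

∈⇒∣p∣>0 : ∀ {n} {x : Fin n} {p : Subset n} → x ∈ p → 0 < ∣ p ∣
∈⇒∣p∣>0 {p = inside ∷ᵥ _} _ = s≤s z≤n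
∈⇒∣p∣>0 {p = outside ∷ᵥ _} (there x∈p) = ∈⇒∣p∣>0 x∈p

∅⊆ᵇ : ∀ {n} (e : Subset n) → (∅ ⊆ᵇ e) ≡ true
∅⊆ᵇ []ᵥ = refl
∅⊆ᵇ (_ ∷ᵥ e) = ∅⊆ᵇ e

⁅x⁆⊆ᵇ : ∀ {n} (x : Fin n) (e : Subset n) → (⁅ x ⁆ ⊆ᵇ e) ≡ lookup e x
⁅x⁆⊆ᵇ fzero (b ∷ᵥ e) = trans (cong (b ∧_) (∅⊆ᵇ e)) (∧-identityʳ b)
⁅x⁆⊆ᵇ (fsuc x) (_ ∷ᵥ e) = ⁅x⁆⊆ᵇ x e

∪⁅y⁆⊆ᵇ : ∀ {n} (F : Subset n) (y : Fin n) (e : Subset n) → ((F ∪ ⁅ y ⁆) ⊆ᵇ e) ≡ (F ⊆ᵇ e) ∧ lookup e y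
∪⁅y⁆⊆ᵇ (b ∷ᵥ F) fzero (c ∷ᵥ e) rewrite ∪-identityʳ F = lemma b c
  where
  lemma : ∀ b c → ((b ∨ true) ∷ᵥ F) ⊆ᵇ (c ∷ᵥ e) ≡ ((b ∷ᵥ F) ⊆ᵇ (c ∷ᵥ e)) ∧ c
  lemma true true = sym (∧-identityʳ (F ⊆ᵇ e))
  lemma true false = refl
  lemma false c = ∧-comm c (F ⊆ᵇ e)
∪⁅y⁆⊆ᵇ (inside ∷ᵥ F) (fsuc y) (c ∷ᵥ e) = trans (cong (c ∧_) (∪⁅y⁆⊆ᵇ F y e)) (sym (∧-assoc c (F ⊆ᵇ e) (lookup e y)))
∪⁅y⁆⊆ᵇ (outside ∷ᵥ F) (fsuc y) (c ∷ᵥ e) = ∪⁅y⁆⊆ᵇ F y e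

∣F∪⁅y⁆∣≡1+∣F∣ : ∀ {n} (F : Subset n) (y : Fin n) → lookup F y ≡ false → ∣ F ∪ ⁅ y ⁆ ∣ ≡ suc ∣ F ∣
∣F∪⁅y⁆∣≡1+∣F∣ (outside ∷ᵥ F) fzero _ rewrite ∪-identityʳ F = refl
∣F∪⁅y⁆∣≡1+∣F∣ (inside ∷ᵥ F) (fsuc y) y∉F = cong suc (∣F∪⁅y⁆∣≡1+∣F∣ F y y∉F)
∣F∪⁅y⁆∣≡1+∣F∣ (outside ∷ᵥ F) (fsuc y) y∉F = ∣F∪⁅y⁆∣≡1+∣F∣ F y y∉F

subsetsOfSize : ∀ n t → count (λ Y → ∣ Y ∣ ≡ᵇ t) (allSubsets n) ≡ n C t
subsetsOfSize n t = begin
  count (λ Y → ∣ Y ∣ ≡ᵇ t) (allSubsets n)   ≡⟨ count-cong (λ Y → trans (cong ((∣ Y ∣ ≡ᵇ t) ∧_) (∅⊆ᵇ Y)) (∧-identityʳ _)) (allSubsets n) ⟨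
  supersetsOfSize (∅ {n}) t                  ≡⟨ cong (supersetsOfSize (∅ {n})) (cong (_+ t) (∣⊥∣≡0 n)) ⟨
  supersetsOfSize (∅ {n}) (∣ ∅ {n} ∣ + t)    ≡⟨ supersetsOfSize-+ (∅ {n}) t ⟩
  (n ∸ ∣ ∅ {n} ∣) C t                        ≡⟨ cong (λ x → (n ∸ x) C t) (∣⊥∣≡0 n) ⟩
  n C t                                      ∎
  where open ≡-Reasoning

Disjoint : ∀ {n} → Subset n → Subset n → Set
Disjoint X Y = ∀ {i} → i ∈ X → i ∉ Y

Disjoint-tail : ∀ {n x y} {X Y : Subset n} → Disjoint (x ∷ᵥ X) (y ∷ᵥ Y) → Disjoint X Y
Disjoint-tail X∩Y≡∅ i∈X i∈Y = X∩Y≡∅ (there i∈X) (there i∈Y)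

∣X∣+∣Y∣≤n : ∀ {n} (X Y : Subset n) → Disjoint X Y → ∣ X ∣ + ∣ Y ∣ ≤ n
∣X∣+∣Y∣≤n []ᵥ []ᵥ _ = z≤n
∣X∣+∣Y∣≤n (inside ∷ᵥ X) (inside ∷ᵥ Y) X∩Y≡∅ = contradiction here (X∩Y≡∅ here)
∣X∣+∣Y∣≤n (inside ∷ᵥ X) (outside ∷ᵥ Y) X∩Y≡∅ = s≤s (∣X∣+∣Y∣≤n X Y (Disjoint-tail X∩Y≡∅))
∣X∣+∣Y∣≤n (outside ∷ᵥ X) (inside ∷ᵥ Y) X∩Y≡∅ = ≤-trans (≤-reflexive (+-suc ∣ X ∣ ∣ Y ∣)) (s≤s (∣X∣+∣Y∣≤n X Y (Disjoint-tail X∩Y≡∅)))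
∣X∣+∣Y∣≤n (outside ∷ᵥ X) (outside ∷ᵥ Y) X∩Y≡∅ = m≤n⇒m≤1+n (∣X∣+∣Y∣≤n X Y (Disjoint-tail X∩Y≡∅))

disjoint-extension : ∀ {n} (X Y : Subset n) t → Disjoint X Y → ∣ Y ∣ ≤ t → ∣ X ∣ + t ≤ n →
  ∃ λ Y′ → Y ⊆ Y′ × Disjoint X Y′ × ∣ Y′ ∣ ≡ t
disjoint-extension []ᵥ []ᵥ zero _ _ _ = []ᵥ , (λ p → p) , (λ ()) , refl
disjoint-extension (inside ∷ᵥ X) (inside ∷ᵥ Y) t X∩Y≡∅ _ _ = contradiction here (X∩Y≡∅ here)
disjoint-extension {suc n} (outside ∷ᵥ X) (inside ∷ᵥ Y) (suc t) X∩Y≡∅ (s≤s ∣Y∣≤t) ∣X∣+t≤n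
  with Y′ , Y⊆Y′ , X∩Y′≡∅ , ∣Y′∣≡t ← disjoint-extension X Y t (Disjoint-tail X∩Y≡∅) ∣Y∣≤t
                                       (≤-pred (≤-trans (≤-reflexive (sym (+-suc ∣ X ∣ t))) ∣X∣+t≤n))
  = inside ∷ᵥ Y′ , (λ { here → here ; (there p) → there (Y⊆Y′ p) }) ,
    (λ { (there p) (there q) → X∩Y′≡∅ p q }) , cong suc ∣Y′∣≡t
disjoint-extension (inside ∷ᵥ X) (outside ∷ᵥ Y) t X∩Y≡∅ ∣Y∣≤t (s≤s ∣X∣+t≤n)
  with Y′ , Y⊆Y′ , X∩Y′≡∅ , ∣Y′∣≡t ← disjoint-extension X Y t (Disjoint-tail X∩Y≡∅) ∣Y∣≤t ∣X∣+t≤n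
  = outside ∷ᵥ Y′ , (λ { (there p) → there (Y⊆Y′ p) }) ,
    (λ { here () ; (there p) (there q) → X∩Y′≡∅ p q }) , ∣Y′∣≡t
disjoint-extension {suc n} (outside ∷ᵥ X) (outside ∷ᵥ Y) t X∩Y≡∅ ∣Y∣≤t ∣X∣+t≤n with ∣ Y ∣ <? t
... | yes ∣Y∣<t with suc t′ ← t
  with Y′ , Y⊆Y′ , X∩Y′≡∅ , ∣Y′∣≡t ← disjoint-extension X Y t′ (Disjoint-tail X∩Y≡∅) (≤-pred ∣Y∣<t)
                                       (≤-pred (≤-trans (≤-reflexive (sym (+-suc ∣ X ∣ t′))) ∣X∣+t≤n))
  = inside ∷ᵥ Y′ , (λ { (there p) → there (Y⊆Y′ p) }) ,
    (λ { (there p) (there q) → X∩Y′≡∅ p q }) , cong suc ∣Y′∣≡t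
... | no ∣Y∣≮t
  with Y′ , Y⊆Y′ , X∩Y′≡∅ , ∣Y′∣≡t ← disjoint-extension X Y t (Disjoint-tail X∩Y≡∅) ∣Y∣≤t
                                       (subst (λ u → ∣ X ∣ + u ≤ n) (≤-antisym ∣Y∣≤t (≮⇒≥ ∣Y∣≮t))
                                         (∣X∣+∣Y∣≤n X Y (Disjoint-tail X∩Y≡∅)))
  = outside ∷ᵥ Y′ , (λ { (there p) → there (Y⊆Y′ p) }) ,
    (λ { (there p) (there q) → X∩Y′≡∅ p q }) , ∣Y′∣≡t

sumUpTo : (ℕ → ℕ) → ℕ → ℕ
sumUpTo f zero = 0
sumUpTo f (suc N) = sumUpTo f N + f (suc N)

sumUpTo-0 : ∀ N → sumUpTo (λ _ → 0) N ≡ 0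
sumUpTo-0 zero = refl
sumUpTo-0 (suc N) = trans (+-identityʳ _) (sumUpTo-0 N)

sumUpTo-+ : ∀ f g N → sumUpTo (λ s → f s + g s) N ≡ sumUpTo f N + sumUpTo g N
sumUpTo-+ f g zero = refl
sumUpTo-+ f g (suc N) rewrite sumUpTo-+ f g N = shuffle (sumUpTo f N) (sumUpTo g N) (f (suc N)) (g (suc N))
  where
  shuffle : ∀ a b c d → a + b + (c + d) ≡ a + c + (b + d)
  shuffle = solve-∀

*-sumUpTo : ∀ m f N → m * sumUpTo f N ≡ sumUpTo (λ s → m * f s) N
*-sumUpTo m f zero = *-zeroʳ m
*-sumUpTo m f (suc N) = trans (*-distribˡ-+ m (sumUpTo f N) (f (suc N))) (cong (_+ m * f (suc N)) (*-sumUpTo m f N))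

term≤sumUpTo : ∀ f {s N} → 0 < s → s ≤ N → f s ≤ sumUpTo f N
term≤sumUpTo f {suc s} {suc N} _ s≤N with suc s ≟ suc N
... | yes refl = m≤n+m _ _
... | no s≢N = ≤-trans (term≤sumUpTo f (s≤s z≤n) (≤-pred (≤∧≢⇒< s≤N s≢N))) (m≤m+n _ _)

sum-sumUpTo : ∀ {A : Set} (G : ℕ → A → ℕ) xs N → sum (map (λ x → sumUpTo (λ s → G s x) N) xs) ≡ sumUpTo (λ s → sum (map (G s) xs)) N
sum-sumUpTo G [] N = sym (sumUpTo-0 N)
sum-sumUpTo G (x ∷ xs) N = trans (cong (sumUpTo (λ s → G s x) N +_) (sum-sumUpTo G xs N))
  (sym (sumUpTo-+ (λ s → G s x) (λ s → sum (map (G s) xs)) N))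

atLevel : ∀ {A : Set} → (A → ℕ) → (A → ℕ) → ℕ → A → ℕ
atLevel σ g s x = if σ x ≡ᵇ s then g x else 0

sum≤sumUpTo-atLevel : ∀ {A : Set} (σ g : A → ℕ) N → (∀ x → σ x ≤ N) → (∀ x → σ x ≡ 0 → g x ≡ 0) →
  ∀ xs → sum (map g xs) ≤ sumUpTo (λ s → sum (map (atLevel σ g s) xs)) N
sum≤sumUpTo-atLevel σ g N σ≤N g₀ xs =
  ≤-trans (sum-map-mono-≤ g≤ xs) (≤-reflexive (sum-sumUpTo (atLevel σ g) xs N))
  where
  g≤ : ∀ x → g x ≤ sumUpTo (λ s → atLevel σ g s x) N
  g≤ x with σ x in σx
  ... | zero = ≤-reflexive (trans (g₀ x σx) (sym (sumUpTo-0′ N)))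
    where
    sumUpTo-0′ : ∀ N → sumUpTo (λ s → if 0 ≡ᵇ s then g x else 0) N ≡ 0
    sumUpTo-0′ zero = refl
    sumUpTo-0′ (suc N) = trans (+-identityʳ _) (sumUpTo-0′ N)
  ... | suc j = ≤-trans (≤-reflexive (sym (diagonal j))) (term≤sumUpTo (λ s → if suc j ≡ᵇ s then g x else 0) (s≤s z≤n) (subst (_≤ N) σx (σ≤N x)))
    where
    diagonal : ∀ j → (if suc j ≡ᵇ suc j then g x else 0) ≡ g x
    diagonal zero = refl
    diagonal (suc j) = diagonal j

sumUpTo≤ : ∀ (d : ℕ → ℕ) T → (∀ s → 0 < s → d s * 2 ^ s ≤ T) → ∀ N → sumUpTo d N ≤ T
sumUpTo≤ d T d≤ N = *-cancelʳ-≤ _ _ (2 ^ N) {{>-nonZero (m^n>0 2 N)}} (≤-trans (m≤m+n _ T) (geometric N))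
  where
  geometric : ∀ N → sumUpTo d N * 2 ^ N + T ≤ T * 2 ^ N
  geometric zero = ≤-reflexive (sym (*-identityʳ T))
  geometric (suc N) = begin
    (sumUpTo d N + d (suc N)) * (2 * 2 ^ N) + T               ≡⟨ expand (sumUpTo d N) (d (suc N)) (2 ^ N) T ⟩
    2 * (sumUpTo d N * 2 ^ N + T) + d (suc N) * (2 * 2 ^ N) ∸ T ≤⟨ ∸-monoˡ-≤ T (+-mono-≤ (*-monoʳ-≤ 2 (geometric N)) (d≤ (suc N) (s≤s z≤n))) ⟩
    2 * (T * 2 ^ N) + T ∸ T                                   ≡⟨ m+n∸n≡m _ T ⟩
    2 * (T * 2 ^ N)                                           ≡⟨ shuffle T (2 ^ N) ⟩
    T * (2 * 2 ^ N)                                           ∎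
    where
    open ≤-Reasoning
    expand₀ : ∀ a b c t → (a + b) * (2 * c) + t + t ≡ 2 * (a * c + t) + b * (2 * c)
    expand₀ = solve-∀
    expand : ∀ a b c t → (a + b) * (2 * c) + t ≡ 2 * (a * c + t) + b * (2 * c) ∸ t
    expand a b c t = trans (sym (m+n∸n≡m ((a + b) * (2 * c) + t) t)) (cong (_∸ t) (expand₀ a b c t))
    shuffle : ∀ t p → 2 * (t * p) ≡ t * (2 * p)
    shuffle = solve-∀

module _ {n : ℕ} where

  *-sumOverSize≤ : ∀ t (c : Subset n → Bool) (g : Subset n → ℕ) W T → t ≤ n →
    (∀ Y → c Y ≡ true → ∣ Y ∣ ≡ t) → (∀ Y → c Y ≡ true → W * (n C t) * g Y ≤ T) →
    W * sum (map (λ Y → if c Y then g Y else 0) (allSubsets n)) ≤ T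
  *-sumOverSize≤ t c g W T t≤n c⇒∣Y∣≡t bound = *-cancelˡ-≤ (n C t) {{>-nonZero (nCk>0 t≤n)}} (begin
    (n C t) * (W * S)                 ≡⟨ shuffle (n C t) W S ⟩
    W * (n C t) * S                   ≤⟨ *-sum-if≤count*T c g (W * (n C t)) T bound (allSubsets n) ⟩
    count c (allSubsets n) * T        ≤⟨ *-monoˡ-≤ T (count-mono (λ Y cY → ≡⇒≡ᵇ≡true (c⇒∣Y∣≡t Y cY)) (allSubsets n)) ⟩
    count (λ Y → ∣ Y ∣ ≡ᵇ t) (allSubsets n) * T ≡⟨ cong (_* T) (subsetsOfSize n t) ⟩
    (n C t) * T                       ∎)
    where
    open ≤-Reasoning
    S : ℕ
    S = sum (map (λ Y → if c Y then g Y else 0) (allSubsets n))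
    shuffle : ∀ a b c → a * (b * c) ≡ b * a * c
    shuffle = solve-∀

  *-sumOverSubsets≤ : ∀ m (g : Subset n → ℕ) T → (∀ X → ∣ X ∣ ≡ 0 → g X ≡ 0) →
    (∀ X → m * 2 ^ ∣ X ∣ * (n C ∣ X ∣) * g X ≤ T) → m * sum (map g (allSubsets n)) ≤ T
  *-sumOverSubsets≤ m g T g₀ bound = begin
    m * sum (map g (allSubsets n))                  ≤⟨ *-monoʳ-≤ m (sum≤sumUpTo-atLevel ∣_∣ g n ∣p∣≤n g₀ (allSubsets n)) ⟩
    m * sumUpTo level n                             ≡⟨ *-sumUpTo m level n ⟩
    sumUpTo (λ s → m * level s) n                   ≤⟨ sumUpTo≤ (λ s → m * level s) T level≤ n ⟩
    T                                               ∎
    where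
    open ≤-Reasoning
    level : ℕ → ℕ
    level s = sum (map (atLevel ∣_∣ g s) (allSubsets n))
    level≤ : ∀ s → 0 < s → m * level s * 2 ^ s ≤ T
    level≤ s _ with s ≤? n
    ... | no s≰n = ≤-trans (≤-reflexive (cong (λ x → m * x * 2 ^ s) (empty-level (allSubsets n)))) (≤-trans (≤-reflexive (cong (_* 2 ^ s) (*-zeroʳ m))) z≤n)
      where
      empty-level : ∀ Xs → sum (map (atLevel ∣_∣ g s) Xs) ≡ 0
      empty-level [] = refl
      empty-level (X ∷ Xs) with ∣ X ∣ ≡ᵇ s in ∣X∣≡s
      ... | false = empty-level Xs
      ... | true = contradiction (subst (_≤ n) (≡ᵇ⇒≡ ∣ X ∣ s (Equivalence.from T-≡ ∣X∣≡s)) (∣p∣≤n X)) s≰n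
    ... | yes s≤n = ≤-trans (≤-reflexive (shuffle m (level s) (2 ^ s)))
      (*-sumOverSize≤ s (λ X → ∣ X ∣ ≡ᵇ s) g (m * 2 ^ s) T s≤n
        (λ X ∣X∣≡s → ≡ᵇ⇒≡ ∣ X ∣ s (Equivalence.from T-≡ ∣X∣≡s))
        (λ X ∣X∣≡s → subst (λ x → m * 2 ^ x * (n C x) * g X ≤ T) (≡ᵇ⇒≡ ∣ X ∣ s (Equivalence.from T-≡ ∣X∣≡s)) (bound X)))
      where
      shuffle : ∀ m l p → m * l * p ≡ m * p * l
      shuffle = solve-∀

does-∈? : ∀ {n} (v : Fin n) (e : Subset n) → does (v ∈? e) ≡ lookup e v
does-∈? fzero (inside ∷ᵥ e) = refl
does-∈? fzero (outside ∷ᵥ e) = refl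
does-∈? (fsuc v) (_ ∷ᵥ e) = does-∈? v e

isEdgeAt : ∀ {n} → ℕ → Fin n → Subset n → Bool
isEdgeAt r v e = (∣ e ∣ ≡ᵇ r) ∧ (⁅ v ⁆ ⊆ᵇ e)

module _ {n : ℕ} (r : ℕ) (v : Fin n) where

  private
    does-edge : ∀ e → does ((∣ e ∣ ≟ r) ×-dec (v ∈? e)) ≡ isEdgeAt r v e
    does-edge e = cong ((∣ e ∣ ≡ᵇ r) ∧_) (trans (does-∈? v e) (sym (⁅x⁆⊆ᵇ v e)))

  length-edgesAt : length (edgesAt n r v) ≡ supersetsOfSize ⁅ v ⁆ r
  length-edgesAt = trans (length-filter (λ e → (∣ e ∣ ≟ r) ×-dec (v ∈? e)) (allSubsets n)) (count-cong does-edge (allSubsets n))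

  count-edgesAt : ∀ p → count p (edgesAt n r v) ≡ count (λ e → isEdgeAt r v e ∧ p e) (allSubsets n)
  count-edgesAt p = trans (count-filter (λ e → (∣ e ∣ ≟ r) ×-dec (v ∈? e)) p (allSubsets n))
    (count-cong (λ e → cong (_∧ p e) (does-edge e)) (allSubsets n))

length-edgesAt≡ : ∀ n R (v : Fin n) → length (edgesAt n (suc R) v) ≡ (n ∸ 1) C R
length-edgesAt≡ n R v = trans (length-edgesAt (suc R) v)
  (subst (λ x → supersetsOfSize ⁅ v ⁆ (x + R) ≡ (n ∸ x) C R) (∣⁅x⁆∣≡1 v) (supersetsOfSize-+ ⁅ v ⁆ R))

edgesThrough : ∀ n R (v y : Fin n) → v ≢ y →
  count (λ e → isEdgeAt (suc (suc R)) v e ∧ lookup e y) (allSubsets n) ≡ (n ∸ 2) C R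
edgesThrough n R v y v≢y = begin
  count (λ e → isEdgeAt (suc (suc R)) v e ∧ lookup e y) (allSubsets n)
    ≡⟨ count-cong (λ e → trans (∧-assoc (∣ e ∣ ≡ᵇ suc (suc R)) (⁅ v ⁆ ⊆ᵇ e) (lookup e y))
                               (cong ((∣ e ∣ ≡ᵇ suc (suc R)) ∧_) (sym (∪⁅y⁆⊆ᵇ ⁅ v ⁆ y e)))) (allSubsets n) ⟩
  supersetsOfSize (⁅ v ⁆ ∪ ⁅ y ⁆) (2 + R)
    ≡⟨ subst (λ x → supersetsOfSize (⁅ v ⁆ ∪ ⁅ y ⁆) (x + R) ≡ (n ∸ x) C R) ∣⁅v,y⁆∣≡2 (supersetsOfSize-+ (⁅ v ⁆ ∪ ⁅ y ⁆) R) ⟩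
  (n ∸ 2) C R ∎
  where
  open ≡-Reasoning
  ∣⁅v,y⁆∣≡2 : ∣ ⁅ v ⁆ ∪ ⁅ y ⁆ ∣ ≡ 2
  ∣⁅v,y⁆∣≡2 = trans (∣F∪⁅y⁆∣≡1+∣F∣ ⁅ v ⁆ y (∉⇒lookup≡false (x≢y⇒x∉⁅y⁆ (v≢y ∘ sym)))) (cong suc (∣⁅x⁆∣≡1 v))

meets : ∀ {n} → Subset n → Subset n → Bool
meets Y e = anyᶠ (λ i → lookup Y i ∧ lookup e i)

meets≡false⁻ : ∀ {n} {Y e : Subset n} → meets Y e ≡ false → ∀ {y} → y ∈ e → y ∉ Y
meets≡false⁻ meets≡false {y} y∈e y∈Y
  with () ← trans (sym (cong₂ _∧_ ([]=⇒lookup y∈Y) ([]=⇒lookup y∈e))) (anyᶠ≡false⁻ _ meets≡false y)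

Disjoint⇒meets≡false : ∀ {n} {X Y : Subset n} → Disjoint X Y → meets X Y ≡ false
Disjoint⇒meets≡false {X = X} {Y} X∩Y≡∅ = anyᶠ≡false⁺ _ not-both
  where
  not-both : ∀ i → lookup X i ∧ lookup Y i ≡ false
  not-both i with lookup X i in Xi
  ... | false = refl
  ... | true = ∉⇒lookup≡false (X∩Y≡∅ (lookup⇒[]= i X Xi))

-- Union bound over the points y of Y: at most (n - 2) C R edges through v contain y.
edgesMeeting≤ : ∀ n R (v : Fin n) (Y : Subset n) → lookup Y v ≡ false →
  count (meets Y) (edgesAt n (suc (suc R)) v) ≤ ∣ Y ∣ * ((n ∸ 2) C R)
edgesMeeting≤ n R v Y v∉Y = begin
  count (meets Y) (edgesAt n r v)
    ≡⟨ trans (count-edgesAt r v (meets Y)) (count-cong (λ e → ∧-anyᶠ n (isEdgeAt r v e) _) (allSubsets n)) ⟩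
  count (λ e → anyᶠ (λ i → isEdgeAt r v e ∧ (lookup Y i ∧ lookup e i))) (allSubsets n)
    ≤⟨ count-anyᶠ n (λ i e → isEdgeAt r v e ∧ (lookup Y i ∧ lookup e i)) (allSubsets n) ⟩
  sumᶠ (λ i → count (λ e → isEdgeAt r v e ∧ (lookup Y i ∧ lookup e i)) (allSubsets n))
    ≤⟨ sumᶠ-mono-≤ n through-y ⟩
  sumᶠ (λ i → if lookup Y i then (n ∸ 2) C R else 0)
    ≡⟨ sumᶠ-if Y ((n ∸ 2) C R) ⟩
  ∣ Y ∣ * ((n ∸ 2) C R) ∎
  where
  open ≤-Reasoning
  r = suc (suc R)
  ∧-anyᶠ : ∀ n b (g : Fin n → Bool) → b ∧ anyᶠ g ≡ anyᶠ (λ i → b ∧ g i)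
  ∧-anyᶠ zero b g = ∧-zeroʳ b
  ∧-anyᶠ (suc n) b g = trans (∧-distribˡ-∨ b (g fzero) (anyᶠ (g ∘ fsuc))) (cong ((b ∧ g fzero) ∨_) (∧-anyᶠ n b (g ∘ fsuc)))
  sumᶠ-mono-≤ : ∀ n {f g : Fin n → ℕ} → (∀ i → f i ≤ g i) → sumᶠ f ≤ sumᶠ g
  sumᶠ-mono-≤ zero f≤g = z≤n
  sumᶠ-mono-≤ (suc n) f≤g = +-mono-≤ (f≤g fzero) (sumᶠ-mono-≤ n (f≤g ∘ fsuc))
  sumᶠ-if : ∀ {n} (Y : Subset n) c → sumᶠ (λ i → if lookup Y i then c else 0) ≡ ∣ Y ∣ * c
  sumᶠ-if []ᵥ c = refl
  sumᶠ-if (inside ∷ᵥ Y) c = cong (c +_) (sumᶠ-if Y c)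
  sumᶠ-if (outside ∷ᵥ Y) c = sumᶠ-if Y c
  through-y : ∀ i → count (λ e → isEdgeAt r v e ∧ (lookup Y i ∧ lookup e i)) (allSubsets n) ≤ (if lookup Y i then (n ∸ 2) C R else 0)
  through-y i with lookup Y i in y∈Y
  ... | false = ≤-reflexive (trans (count-cong (λ e → ∧-zeroʳ (isEdgeAt r v e)) (allSubsets n)) (count-false (allSubsets n)))
  ... | true = ≤-reflexive (edgesThrough n R v i (λ { refl → contradiction (trans (sym v∉Y) y∈Y) λ () }))

edgesMeeting*n≤ : ∀ n′ R (v : Fin (2 + n′)) (Y : Subset (2 + n′)) → lookup Y v ≡ false →
  count (meets Y) (edgesAt (2 + n′) (2 + R) v) * (2 + n′) ≤ 2 * suc R * ∣ Y ∣ * length (edgesAt (2 + n′) (2 + R) v)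
edgesMeeting*n≤ n′ R v Y v∉Y = begin
  a * (2 + n′)                                ≤⟨ *-monoʳ-≤ a (s≤s (m≤n+m (suc n′) n′)) ⟩
  a * (suc n′ + suc n′)                       ≤⟨ *-monoˡ-≤ (suc n′ + suc n′) (edgesMeeting≤ (2 + n′) R v Y v∉Y) ⟩
  ∣ Y ∣ * (n′ C R) * (suc n′ + suc n′)        ≡⟨ shuffle ∣ Y ∣ (n′ C R) (suc n′) ⟩
  2 * ∣ Y ∣ * (suc n′ * (n′ C R))             ≡⟨ cong (2 * ∣ Y ∣ *_) ([k+1]*[n+1]C[k+1]≡[n+1]*nCk n′ R) ⟨
  2 * ∣ Y ∣ * (suc R * (suc n′ C suc R))      ≡⟨ cong (λ x → 2 * ∣ Y ∣ * (suc R * x)) (length-edgesAt≡ (2 + n′) (suc R) v) ⟨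
  2 * ∣ Y ∣ * (suc R * M)                     ≡⟨ shuffle′ ∣ Y ∣ (suc R) M ⟩
  2 * suc R * ∣ Y ∣ * M                       ∎
  where
  open ≤-Reasoning
  a M : ℕ
  a = count (meets Y) (edgesAt (2 + n′) (2 + R) v)
  M = length (edgesAt (2 + n′) (2 + R) v)
  shuffle : ∀ y b m → y * b * (m + m) ≡ 2 * y * (m * b)
  shuffle = solve-∀
  shuffle′ : ∀ y R m → 2 * y * (R * m) ≡ 2 * R * y * m
  shuffle′ = solve-∀

count-all-kChoices : ∀ {A : Set} (p : A → Bool) k xs → k ≤ length xs →
  count (all p) (kChoices k xs) * length xs ^ k ≤ length (kChoices k xs) * count p xs ^ k
count-all-kChoices p k xs k≤∣xs∣ with length xs <? k
... | yes ∣xs∣<k = contradiction ∣xs∣<k (≤⇒≯ k≤∣xs∣)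
... | no _ rewrite count-all-choose p k xs | length-choose k xs = aCk*M^k≤MCk*a^k k (count≤length p xs)

rescale : ∀ {c L a M n B} k → 0 < M → c * M ^ k ≤ L * a ^ k → a * n ≤ B * M → c * n ^ k ≤ L * B ^ k
rescale {c} {L} {a} {M} {n} {B} k M>0 cM^k≤La^k an≤BM = *-cancelʳ-≤ _ _ (M ^ k) {{>-nonZero (m^n>0 M {{>-nonZero M>0}} k)}} (begin
  c * n ^ k * M ^ k      ≡⟨ swap₂ c (n ^ k) (M ^ k) ⟩
  c * M ^ k * n ^ k      ≤⟨ *-monoˡ-≤ (n ^ k) cM^k≤La^k ⟩
  L * a ^ k * n ^ k      ≡⟨ trans (*-assoc L (a ^ k) (n ^ k)) (cong (L *_) (sym (^-distribʳ-* a n k))) ⟩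
  L * (a * n) ^ k        ≤⟨ *-monoʳ-≤ L (^-monoˡ-≤ k an≤BM) ⟩
  L * (B * M) ^ k        ≡⟨ trans (cong (L *_) (^-distribʳ-* B M k)) (sym (*-assoc L (B ^ k) (M ^ k))) ⟩
  L * B ^ k * M ^ k      ∎)
  where
  open ≤-Reasoning
  swap₂ : ∀ b x y → b * x * y ≡ b * y * x
  swap₂ = solve-∀

choicesAvoiding≤ : ∀ n′ R k (v : Fin (2 + n′)) (Y : Subset (2 + n′)) → lookup Y v ≡ false → k ≤ suc n′ → R < n′ →
  count (all (meets Y)) (kChoices k (edgesAt (2 + n′) (2 + R) v)) * (2 + n′) ^ k
    ≤ length (kChoices k (edgesAt (2 + n′) (2 + R) v)) * (2 * suc R * ∣ Y ∣) ^ k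
choicesAvoiding≤ n′ R k v Y v∉Y k≤1+n′ R<n′ =
  rescale {c = count (all (meets Y)) (kChoices k E)} {L = length (kChoices k E)} {a = count (meets Y) E} {M = length E}
    k (≤-trans (s≤s z≤n) 1+n′≤M) (count-all-kChoices (meets Y) k E (≤-trans k≤1+n′ 1+n′≤M)) (edgesMeeting*n≤ n′ R v Y v∉Y)
  where
  E : List (Subset (2 + n′))
  E = edgesAt (2 + n′) (2 + R) v
  1+n′≤M : suc n′ ≤ length E
  1+n′≤M = subst (suc n′ ≤_) (sym (length-edgesAt≡ (2 + n′) (suc R) v)) (n≤nCk (s≤s z≤n) (s≤s R<n′))

∈-sequence : ∀ {A : Set} n (L : Fin n → List A) {ω} → ω ∈ˡ sequenceV (tabulate L) → ∀ i → lookup ω i ∈ˡ L i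
∈-sequence (suc n) L ω∈ i
  with x , x∈L₀ , ω∈ ← find (∈-concatMap⁻ (λ x → map (x ∷ᵥ_) (sequenceV (tabulate (L ∘ fsuc)))) {xs = L fzero} ω∈)
  with ω′ , ω′∈ , refl ← ∈-map⁻ (x ∷ᵥ_) ω∈
  with i
... | fzero = x∈L₀
... | fsuc i = ∈-sequence n (L ∘ fsuc) ω′∈ i

∈-choose : ∀ {A : Set} k (xs : List A) {l e} → l ∈ˡ choose k xs → e ∈ˡ l → e ∈ˡ xs
∈-choose zero xs (here refl) ()
∈-choose (suc k) (x ∷ xs) l∈ e∈l with ∈-++⁻ (map (x ∷_) (choose k xs)) l∈
... | inj₂ l∈′ = there (∈-choose (suc k) xs l∈′ e∈l)
... | inj₁ l∈′ with l′ , l′∈ , refl ← ∈-map⁻ (x ∷_) l∈′ with e∈l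
...   | here refl = here refl
...   | there e∈l′ = there (∈-choose k xs l′∈ e∈l′)

∈-kChoices : ∀ {A : Set} k (xs : List A) {l e} → l ∈ˡ kChoices k xs → e ∈ˡ l → e ∈ˡ xs
∈-kChoices k xs l∈ e∈l with length xs <? k
... | yes _ with here refl ← l∈ = e∈l
... | no _ = ∈-choose k xs l∈ e∈l

∈-edgesAt : ∀ n r v {e} → e ∈ˡ edgesAt n r v → v ∈ e
∈-edgesAt n r v e∈ = proj₂ (proj₂ (∈-filter⁻ (λ e → (∣ e ∣ ≟ r) ×-dec (v ∈? e)) {xs = allSubsets n} e∈))

chosenEdge-∋ : ∀ {n r k ω} → ω ∈ˡ outcomes n r k → ∀ i {e} → e ∈ˡ lookup ω i → i ∈ e
chosenEdge-∋ {n} {r} {k} ω∈ i e∈ =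
  ∈-edgesAt n r i (∈-kChoices k (edgesAt n r i) (∈-sequence n (λ v → kChoices k (edgesAt n r v)) ω∈ i) e∈)

kChoices-nonempty : ∀ {A : Set} k (xs : List A) {l} → 0 < k → (∃ λ x → x ∈ˡ xs) → l ∈ˡ kChoices k xs → ∃ λ e → e ∈ˡ l
kChoices-nonempty k xs 0<k xs≢[] l∈ with length xs <? k
... | yes _ with here refl ← l∈ = xs≢[]
kChoices-nonempty (suc k) xs _ _ l∈ | no _ = choose-nonempty xs l∈
  where
  choose-nonempty : ∀ xs {l} → l ∈ˡ choose (suc k) xs → ∃ λ e → e ∈ˡ l
  choose-nonempty (x ∷ xs) l∈ with ∈-++⁻ (map (x ∷_) (choose k xs)) l∈
  ... | inj₂ l∈′ = choose-nonempty xs l∈′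
  ... | inj₁ l∈′ with _ , _ , refl ← ∈-map⁻ (x ∷_) l∈′ = x , here refl

-- The bad event

module BadEvent (n R k : ℕ) where

  open Exponent R using (r; q)

  choices : Fin n → List (List (Subset n))
  choices v = kChoices k (edgesAt n r v)

  space : List (Outcome n)
  space = outcomes n r k

  trapped : Subset n → Subset n → Outcome n → Bool
  trapped X Y ω = allᶠ (λ i → not (lookup X i) ∨ all (meets Y) (lookup ω i))

  small : Subset n → Bool
  small X = (1 ≤ᵇ ∣ X ∣) ∧ (q * ∣ X ∣ ≤ᵇ n)

  -- Blocking sets are taken of size exactly R |X|: a smaller one extends to one of that
  -- size (disjoint-extension), which every edge from X still meets.
  blocking : Subset n → Subset n → Bool
  blocking X Y = (∣ Y ∣ ≡ᵇ R * ∣ X ∣) ∧ not (meets X Y)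

  bad : Outcome n → Bool
  bad ω = any (λ X → small X ∧ any (λ Y → blocking X Y ∧ trapped X Y ω) (allSubsets n)) (allSubsets n)

  small⁻ : ∀ X → small X ≡ true → 1 ≤ ∣ X ∣ × q * ∣ X ∣ ≤ n
  small⁻ X small-X = ≤ᵇ⇒≤ 1 ∣ X ∣ (Equivalence.from T-≡ (∧-conicalˡ (1 ≤ᵇ ∣ X ∣) _ small-X)) ,
                     ≤ᵇ⇒≤ (q * ∣ X ∣) n (Equivalence.from T-≡ (∧-conicalʳ (1 ≤ᵇ ∣ X ∣) _ small-X))

  blocking⁻ : ∀ X Y → blocking X Y ≡ true → ∣ Y ∣ ≡ R * ∣ X ∣ × Disjoint X Y
  blocking⁻ X Y blocking-Y =
    ≡ᵇ⇒≡ ∣ Y ∣ (R * ∣ X ∣) (Equivalence.from T-≡ (∧-conicalˡ (∣ Y ∣ ≡ᵇ R * ∣ X ∣) _ blocking-Y)) ,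
    λ i∈X i∈Y → meets≡false⁻ (not-injective (∧-conicalʳ (∣ Y ∣ ≡ᵇ R * ∣ X ∣) (not (meets X Y)) blocking-Y)) i∈Y i∈X

  trapped≡false⁻ : ∀ {X Y ω} → trapped X Y ω ≡ false → ∃ λ i → i ∈ X × ∃ λ e → e ∈ˡ lookup ω i × meets Y e ≡ false
  trapped≡false⁻ {X} {Y} {ω} trapped≡false
    with i , i-escapes ← allᶠ≡false⁻ (λ i → not (lookup X i) ∨ all (meets Y) (lookup ω i)) trapped≡false
    with e , e∈ , e-avoids ← all≡false⁻ (meets Y) (lookup ω i) (∨-conicalʳ (not (lookup X i)) _ i-escapes)
    = i , lookup⇒[]= i X (not-injective (∨-conicalˡ (not (lookup X i)) _ i-escapes)) , e , e∈ , e-avoids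

  ¬bad⇒expansive : ∀ {ω} → ω ∈ˡ space → bad ω ≡ false →
    (X : Subset n) → Nonempty X → q * ∣ X ∣ ≤ n → Expansive (outHypergraph ω) R X
  ¬bad⇒expansive {ω} ω∈ bad≡false X X≢∅@(_ , x∈X) q∣X∣≤n = X≢∅ , escape
    where
    small-X : small X ≡ true
    small-X = cong₂ _∧_ (≤⇒≤ᵇ≡true (∈⇒∣p∣>0 x∈X)) (≤⇒≤ᵇ≡true q∣X∣≤n)
    no-trap : ∀ Y → blocking X Y ≡ true → trapped X Y ω ≡ false
    no-trap Y blocking≡true = true∧b≡false blocking≡true
      (any≡false⁻ (λ Y → blocking X Y ∧ trapped X Y ω)
        (true∧b≡false small-X (any≡false⁻ (λ X → small X ∧ any (λ Y → blocking X Y ∧ trapped X Y ω) (allSubsets n))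
                                 bad≡false (∈-allSubsets X)))
        (∈-allSubsets Y))
    escape : (Y : Subset n) → (∀ y → y ∈ Y → y ∉ X) → ∣ Y ∣ ≤ R * ∣ X ∣ →
      ∃ λ e → outHypergraph ω e × (∃ λ x → x ∈ e × x ∈ X) × (∀ y → y ∈ e → y ∉ Y)
    escape Y Y∩X≡∅ ∣Y∣≤R∣X∣
      with Y′ , Y⊆Y′ , X∩Y′≡∅ , ∣Y′∣≡R∣X∣ ← disjoint-extension X Y (R * ∣ X ∣) (λ i∈X i∈Y → Y∩X≡∅ _ i∈Y i∈X) ∣Y∣≤R∣X∣
                                             (≤-trans (*-monoˡ-≤ ∣ X ∣ (r≤2*r^2 r)) q∣X∣≤n)
      with i , i∈X , e , e∈ , e-avoids ← trapped≡false⁻ {X} {Y′} {ω} (no-trap Y′ (cong₂ _∧_ (≡⇒≡ᵇ≡true ∣Y′∣≡R∣X∣)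
                                                                    (cong not (Disjoint⇒meets≡false X∩Y′≡∅))))
      = e , (i , e∈) , (i , chosenEdge-∋ {n} {r} {k} ω∈ i e∈ , i∈X) , λ y y∈e y∈Y → meets≡false⁻ e-avoids y∈e (Y⊆Y′ y∈Y)

-- The first moment bound

module _ (n′ R′ : ℕ) where

  private
    n R : ℕ
    n = 2 + n′
    R = suc R′

  open Exponent R using (r; k; m*2^s*nCs*nCt*Z^s≤[n^k]^s)
  open BadEvent n R k

  module _ (k≤1+n′ : k ≤ suc n′) (R′<n′ : R′ < n′) where

    count-trapped≤ : ∀ X Y → Disjoint X Y →
      count (trapped X Y) space * (n ^ k) ^ ∣ X ∣ ≤ length space * ((2 * R * ∣ Y ∣) ^ k) ^ ∣ X ∣
    count-trapped≤ X Y X∩Y≡∅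
      rewrite count-allᶠ-sequence n (λ i l → not (lookup X i) ∨ all (meets Y) l) choices
            | length-sequence n choices
      = productᶠ*D^∣X∣≤productᶠ*B^∣X∣ X _ _ (n ^ k) ((2 * R * ∣ Y ∣) ^ k) inside-X outside-X
      where
      inside-X : ∀ i → lookup X i ≡ true →
        count (λ l → not (lookup X i) ∨ all (meets Y) l) (choices i) * n ^ k ≤ length (choices i) * (2 * R * ∣ Y ∣) ^ k
      inside-X i i∈X rewrite i∈X =
        choicesAvoiding≤ n′ R′ k i Y (∉⇒lookup≡false (X∩Y≡∅ (lookup⇒[]= i X i∈X))) k≤1+n′ R′<n′
      outside-X : ∀ i → lookup X i ≡ false → count (λ l → not (lookup X i) ∨ all (meets Y) l) (choices i) ≤ length (choices i)
      outside-X i i∉X rewrite i∉X = ≤-reflexive (count-true (choices i))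

    module _ {m : ℕ} (m≤n : m ≤ n) where

      trappedBy : Subset n → ℕ
      trappedBy X = sum (map (λ Y → if blocking X Y then count (trapped X Y) space else 0) (allSubsets n))

      module _ (X : Subset n) (small-X : small X ≡ true) where

        private
          s t : ℕ
          s = ∣ X ∣
          t = R * s

          1≤s : 1 ≤ s
          1≤s = proj₁ (small⁻ X small-X)

          qs≤n : 2 * r ^ 2 * s ≤ n
          qs≤n = proj₂ (small⁻ X small-X)

        m*2^s*nCs*nCt*count-trapped≤ : ∀ Y → blocking X Y ≡ true →
          m * 2 ^ s * (n C s) * (n C t) * count (trapped X Y) space ≤ length space
        m*2^s*nCs*nCt*count-trapped≤ Y blocking-Y =
          *-cancelʳ-≤ _ _ ((n ^ k) ^ s) {{>-nonZero (m^n>0 (n ^ k) {{>-nonZero (m^n>0 n k)}} s)}} (begin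
          W * c * (n ^ k) ^ s                          ≡⟨ *-assoc W c _ ⟩
          W * (c * (n ^ k) ^ s)                        ≤⟨ *-monoʳ-≤ W trapped≤ ⟩
          W * (length space * Z ^ s)                   ≡⟨ shuffle W (length space) (Z ^ s) ⟩
          length space * (W * Z ^ s)                   ≤⟨ *-monoʳ-≤ (length space) (m*2^s*nCs*nCt*Z^s≤[n^k]^s (s≤s z≤n) 1≤s qs≤n m≤n) ⟩
          length space * (n ^ k) ^ s                   ∎)
          where
          open ≤-Reasoning
          W c Z : ℕ
          W = m * 2 ^ s * (n C s) * (n C t)
          c = count (trapped X Y) space
          Z = (2 * R * t) ^ k
          shuffle : ∀ a b c → a * (b * c) ≡ b * (a * c)
          shuffle = solve-∀
          trapped≤ : c * (n ^ k) ^ s ≤ length space * Z ^ s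
          trapped≤ = subst (λ x → c * (n ^ k) ^ s ≤ length space * ((2 * R * x) ^ k) ^ s) (proj₁ (blocking⁻ X Y blocking-Y))
                       (count-trapped≤ X Y (proj₂ (blocking⁻ X Y blocking-Y)))

        trappedBy≤ : m * 2 ^ s * (n C s) * trappedBy X ≤ length space
        trappedBy≤ = *-sumOverSize≤ t (blocking X) (λ Y → count (trapped X Y) space) (m * 2 ^ s * (n C s)) (length space)
          (≤-trans (*-monoˡ-≤ s (≤-trans (n≤1+n R) (r≤2*r^2 r))) qs≤n) (λ Y → proj₁ ∘ blocking⁻ X Y) m*2^s*nCs*nCt*count-trapped≤

      m*count-bad≤length : m * count bad space ≤ length space
      m*count-bad≤length = begin
        m * count bad space                       ≤⟨ *-monoʳ-≤ m (≤-trans (count-any (λ X ω → small X ∧ _) (allSubsets n) space) (sum-map-mono-≤ by-X (allSubsets n))) ⟩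
        m * sum (map badFor (allSubsets n))       ≤⟨ *-sumOverSubsets≤ m badFor (length space) badFor-∅ badFor≤ ⟩
        length space                              ∎
        where
        open ≤-Reasoning
        badFor : Subset n → ℕ
        badFor X = if small X then trappedBy X else 0
        by-X : ∀ X → count (λ ω → small X ∧ any (λ Y → blocking X Y ∧ trapped X Y ω) (allSubsets n)) space ≤ badFor X
        by-X X rewrite count-∧ (small X) (λ ω → any (λ Y → blocking X Y ∧ trapped X Y ω) (allSubsets n)) space with small X
        ... | false = ≤-refl
        ... | true = ≤-trans (count-any (λ Y ω → blocking X Y ∧ trapped X Y ω) (allSubsets n) space)
                       (≤-reflexive (cong sum (map-cong (λ Y → count-∧ (blocking X Y) (trapped X Y) space) (allSubsets n))))
        badFor-∅ : ∀ X → ∣ X ∣ ≡ 0 → badFor X ≡ 0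
        badFor-∅ X ∣X∣≡0 rewrite ∣X∣≡0 = refl
        badFor≤ : ∀ X → m * 2 ^ ∣ X ∣ * (n C ∣ X ∣) * badFor X ≤ length space
        badFor≤ X with small X in small-X
        ... | true = trappedBy≤ X small-X
        ... | false = ≤-trans (≤-reflexive (*-zeroʳ (m * 2 ^ ∣ X ∣ * (n C ∣ X ∣)))) z≤n

badEvent-rare : ∀ R′ m → ∃ λ N → ∀ n → N ≤ n →
  let open Exponent (suc R′) using (r; k) in m * count (BadEvent.bad n (suc R′) k) (outcomes n r k) ≤ length (outcomes n r k)
badEvent-rare R′ m = 2 + (k + m + R′) , rare
  where
  open Exponent (suc R′) using (r; k; 1+r≤k)
  rare : ∀ n → 2 + (k + m + R′) ≤ n → m * count (BadEvent.bad n (suc R′) k) (outcomes n r k) ≤ length (outcomes n r k)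
  rare (suc (suc n′)) (s≤s (s≤s k+m+R′≤n′)) = m*count-bad≤length n′ R′ k≤1+n′ R′<n′ m≤2+n′
    where
    k≤1+n′ : k ≤ suc n′
    k≤1+n′ = m≤n⇒m≤1+n (≤-trans (≤-trans (m≤m+n k m) (m≤m+n (k + m) R′)) k+m+R′≤n′)
    R′<n′ : R′ < n′
    R′<n′ = ≤-trans (+-monoˡ-≤ R′ (≤-trans (≤-trans (s≤s z≤n) 1+r≤k) (m≤m+n k m))) k+m+R′≤n′
    m≤2+n′ : m ≤ 2 + n′
    m≤2+n′ = ≤-trans (≤-trans (m≤n+m m k) (m≤m+n (k + m) R′)) (≤-trans k+m+R′≤n′ (≤-trans (n≤1+n n′) (n≤1+n (suc n′))))

probTendsToOne-viaBad : ∀ {Ω : ℕ → Set} {space : (n : ℕ) → List (Ω n)} {P : (n : ℕ) → Ω n → Set}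
  (bad : ∀ n → Ω n → Bool) → (∀ n {ω} → ω ∈ˡ space n → bad n ω ≡ false → P n ω) →
  (∀ m → ∃ λ N → ∀ n → N ≤ n → m * count (bad n) (space n) ≤ length (space n)) →
  ProbTendsToOne Ω space P
probTendsToOne-viaBad {Ω} {space} {P} bad ¬bad⇒P rare m with N , bad-rare ← rare m =
  N , λ n N≤n → good n , filter-⊆ (λ ω → T? (not (bad n ω))) (space n) , All-good n ,
    subst (λ x → m * x ≤ length (space n)) (sym (#bad n)) (bad-rare n N≤n)
  where
  good : ∀ n → List (Ω n)
  good n = filterᵇ (not ∘ bad n) (space n)
  All-good : ∀ n → All (P n) (good n)
  All-good n = All.tabulate λ ω∈ → let ω∈space , ¬bad = ∈-filter⁻ (λ ω → T? (not (bad n ω))) {xs = space n} ω∈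
                                   in ¬bad⇒P n ω∈space (not-injective (Equivalence.to T-≡ ¬bad))
  #bad : ∀ n → length (space n) ∸ length (good n) ≡ count (bad n) (space n)
  #bad n = begin
    length (space n) ∸ length (good n)
      ≡⟨ cong (_∸ length (good n)) (count+count-not (bad n) (space n)) ⟨
    count (bad n) (space n) + count (not ∘ bad n) (space n) ∸ length (good n)
      ≡⟨ cong (count (bad n) (space n) + count (not ∘ bad n) (space n) ∸_) (length-filter (λ ω → T? (not (bad n ω))) (space n)) ⟩
    count (bad n) (space n) + count (not ∘ bad n) (space n) ∸ count (not ∘ bad n) (space n)
      ≡⟨ m+n∸n≡m (count (bad n) (space n)) (count (not ∘ bad n) (space n)) ⟩
    count (bad n) (space n) ∎
    where open ≡-Reasoning

expansive-r≡1 : ∀ {n ω} → ω ∈ˡ outcomes n 1 2 → (X : Subset n) → Nonempty X → Expansive (outHypergraph ω) 0 X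
expansive-r≡1 {n} {ω} ω∈ X X≢∅@(x , x∈X) = X≢∅ , λ Y _ ∣Y∣≤0 →
  let e , e∈ = kChoices-nonempty 2 (edgesAt n 1 x) (s≤s z≤n) (⁅ x ⁆ , ⁅x⁆∈edgesAt) (∈-sequence n (λ v → kChoices 2 (edgesAt n 1 v)) ω∈ x)
  in e , (x , e∈) , (x , chosenEdge-∋ {n} {1} {2} ω∈ x e∈ , x∈X) , λ _ _ y∈Y → <⇒≱ (∈⇒∣p∣>0 y∈Y) ∣Y∣≤0
  where
  ⁅x⁆∈edgesAt : ⁅ x ⁆ ∈ˡ edgesAt n 1 x
  ⁅x⁆∈edgesAt = ∈-filter⁺ (λ e → (∣ e ∣ ≟ 1) ×-dec (x ∈? e)) (∈-allSubsets ⁅ x ⁆) (∣⁅x⁆∣≡1 x , x∈⁅x⁆ x)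

lemma7 : (r : ℕ) → 1 ≤ r →
    ProbTendsToOne Outcome (λ n → outcomes n r ((2 * r ^ 2) ^ r))
      (λ n ω → (X : Subset n) → Nonempty X → (2 * r ^ 2) * ∣ X ∣ ≤ n →
         Expansive (outHypergraph ω) (r ∸ 1) X)
lemma7 (suc zero) _ = probTendsToOne-viaBad (λ _ _ → false) (λ _ ω∈ _ X X≢∅ _ → expansive-r≡1 ω∈ X X≢∅)
  λ m → 0 , λ n _ → ≤-trans (≤-reflexive (trans (cong (m *_) (count-false (outcomes n 1 2))) (*-zeroʳ m))) z≤n
lemma7 (suc (suc R′)) _ =
  probTendsToOne-viaBad (λ n → BadEvent.bad n (suc R′) k) (λ n → BadEvent.¬bad⇒expansive n (suc R′) k) (badEvent-rare R′)
  where open Exponent (suc R′) using (k)
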